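{- Let $n$ be odd and $s_1,\dots,s_n$ pairwise distinct nonzero integers, $\mathbf{s}=(s_1,\dots,s_n)$. Then $$\sum_{\sigma\in S_n}\operatorname{sgn}(\sigma)\zeta^{\mathcal{A}}_{\mathbb{Q}}(\sigma(\mathbf{s}))=0\quad\text{in }\mathcal{A}_{\mathbb{Q}},$$ where $\sigma(\mathbf{s})=(s_{\sigma(1)},\dots,s_{\sigma(n)})$.
   Context: $\mathcal{A}_{\mathbb{Q}}:=\prod_p\mathbb{F}_p\big/\bigoplus_p\mathbb{F}_p$ over all primes $p$. For $\mathbf{s}=(s_1,\dots,s_r)\in\mathbb{Z}^r$, the finite multiple zeta value $\zeta^{\mathcal{A}}_{\mathbb{Q}}(\mathbf{s})$ is the class in $\mathcal{A}_{\mathbb{Q}}$ of $\big(\sum_{p>m_1>\cdots>m_r\ge1}m_1^{ -s_1}\cdots m_r^{ -s_r}\bmod p\big)_p$. $S_n$ is the symmetric group with sign character $\operatorname{sgn}$. -}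

module Defs where

open import Data.Nat as ℕ using (ℕ; zero; suc; _^_)
open import Data.Nat.Properties using (_<?_; m^n≢0)
open import Data.Integer as ℤ using (ℤ; +_; -[1+_])
open import Data.Rational as ℚ using (ℚ; _/_)
open import Data.Fin as Fin using (Fin; toℕ)
open import Data.Fin.Properties using (_≟_)
open import Data.Vec as Vec using (Vec; []; _∷_; lookup; toList)
open import Data.List as List using (List; []; _∷_; concatMap; filter; length; allFin; upTo; map; foldr)
open import Data.List.Relation.Unary.Unique.DecPropositional using (unique?)
open import Data.Product using (_×_; _,_; proj₁; proj₂)

-- m^{-s} as a rational number, for the positive integer m = suc m'.
powNeg : ℕ → ℤ → ℚ
powNeg m' (+ k)    = _/_ (+ 1) (suc m' ^ k) {{m^n≢0 (suc m') k}}
powNeg m' -[1+ k ] = (+ (suc m' ^ suc k)) / 1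

sumℚ : List ℚ → ℚ
sumℚ = foldr ℚ._+_ ℚ.0ℚ

-- Multiple harmonic sum (a rational number)
--   H N (s₁,…,s_r) = Σ_{N > m₁ > ⋯ > m_r ≥ 1} m₁^{-s₁} ⋯ m_r^{-s_r}.
-- Recursion: H N (s ∷ ss) = Σ_{m = 1}^{N-1} m^{-s} · H m ss   (upTo (N-1) = 0,…,N-2 = m-1).
H : ℕ → List ℤ → ℚ
H N []       = ℚ.1ℚ
H N (s ∷ ss) = sumℚ (map (λ m' → powNeg m' s ℚ.* H (suc m') ss) (upTo (ℕ.pred N)))

allVecs : (n k : ℕ) → List (Vec (Fin n) k)
allVecs n zero    = [] ∷ []
allVecs n (suc k) = concatMap (λ i → map (i ∷_) (allVecs n k)) (allFin n)

-- The symmetric group S_n, enumerated (each element exactly once) as the list of all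
-- bijections σ : Fin n → Fin n, given by their value tables (σ(1),…,σ(n)),
-- i.e. the injective tables.
permutations : (n : ℕ) → List (Vec (Fin n) n)
permutations n = filter (λ v → unique? _≟_ (toList v)) (allVecs n n)

orderedPairs : (n : ℕ) → List (Fin n × Fin n)
orderedPairs n =
  filter (λ ij → toℕ (proj₁ ij) <? toℕ (proj₂ ij))
    (concatMap (λ i → map (i ,_) (allFin n)) (allFin n))

inversions : {n : ℕ} → Vec (Fin n) n → ℕ
inversions {n} σ =
  length (filter (λ ij → toℕ (lookup σ (proj₂ ij)) <? toℕ (lookup σ (proj₁ ij))) (orderedPairs n))

negOnePow : ℕ → ℚ
negOnePow zero    = ℚ.1ℚ
negOnePow (suc k) = ℚ.- negOnePow k

sgn : {n : ℕ} → Vec (Fin n) n → ℚ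
sgn σ = negOnePow (inversions σ)

act : {n : ℕ} → Vec (Fin n) n → Vec ℤ n → List ℤ
act σ s = toList (Vec.map (lookup s) σ)

-- p-component (as a rational, p-integral for p prime > all m) of
--   Σ_{σ ∈ S_n} sgn(σ) ζ^A(σ(s)):  Σ_σ sgn(σ) · H p (σ(s)).
altSum : (p n : ℕ) → Vec ℤ n → ℚ
altSum p n s = sumℚ (map (λ σ → sgn σ ℚ.* H p (act σ s)) (permutations n))

-- A family (x_p)_p of rationals with x_p p-integral for large p is zero in A_Q:
-- for all but finitely many primes p, x_p ≡ 0 mod p, i.e. p divides the numerator
-- of x_p in lowest terms (the denominator of x_p being coprime to p).
open import Data.Nat.Primality using (Prime)
open import Data.Nat.Divisibility using (_∣_)
open import Data.Product using (∃-syntax)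

ZeroInA : (ℕ → ℚ) → Set
ZeroInA x = ∃[ N ] (∀ p → Prime p → N ℕ.< p → p ∣ ℤ.∣ ℚ.↥ (x p) ∣)

{-# OPTIONS --safe #-}

-- Let A_K(s) = Σ_σ sgn σ H_{K+1}(σ s), so that the p-component is A_{p-1}(s). Splitting the sum over
-- S_{n+1} by the entry that carries the largest summation index shows that A_K satisfies a
-- Laplace-type recursion, from which one gets the Newton-type identity
--   Σᵢ (-1)ⁱ Z_K(sᵢ) A_K(s without sᵢ) = [n odd] · A_K(s),   Z_K(t) = Σ_{0<m≤K} m^{-t};
-- the cross terms cancel because a doubly alternating sum of a symmetric expression vanishes.
-- For K = p - 1 and 0 < |t| < p - 1, Fermat's little theorem turns Z_K(t) into a power sum
-- Σ_{m<p} m^e with 0 < e < p - 1, and these vanish mod p by induction on e, using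
-- Σ_{j≤e} C(e+1, j) Σ_{m<p} m^j = p^{e+1}. All A_K are p-integral, so for odd n the alternating
-- sum is divisible by every prime p > 1 + Σᵢ |sᵢ|.

module Submission where

open import Defs
open import Data.Nat using (ℕ; zero; suc; _%_)
open import Data.Integer using (ℤ; 0ℤ)
open import Data.Vec using (Vec; []; _∷_; lookup)
open import Data.Fin using (Fin)
open import Data.Nat.Primality using (Prime)
open import Data.List using (List; []; _∷_; map; _++_; concatMap)
open import Relation.Binary.PropositionalEquality

private variable
  A B : Set

-- Alternating expansions and a Newton-type identity

module _ where
  open import Data.Rational as ℚ using (ℚ; 0ℚ; 1ℚ; _+_; _*_; -_; _-_)
  import Data.Rational.Properties as ℚₚ
  open import Data.Rational.Solver using (module +-*-Solver)
  open +-*-Solver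
  open ≡-Reasoning

  sumℚ-zero : {f : A → ℚ} → (∀ x → f x ≡ 0ℚ) → (xs : List A) → sumℚ (map f xs) ≡ 0ℚ
  sumℚ-zero f≗0 []       = refl
  sumℚ-zero f≗0 (x ∷ xs) = cong₂ _+_ (f≗0 x) (sumℚ-zero f≗0 xs)

  sumℚ-++ : (f : A → ℚ) (xs ys : List A) →
    sumℚ (map f (xs ++ ys)) ≡ sumℚ (map f xs) + sumℚ (map f ys)
  sumℚ-++ f []       ys = sym (ℚₚ.+-identityˡ _)
  sumℚ-++ f (x ∷ xs) ys = trans (cong (f x +_) (sumℚ-++ f xs ys)) (sym (ℚₚ.+-assoc (f x) _ _))

  sumℚ-+ : (f g : A → ℚ) (xs : List A) →
    sumℚ (map (λ x → f x + g x) xs) ≡ sumℚ (map f xs) + sumℚ (map g xs)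
  sumℚ-+ f g []       = refl
  sumℚ-+ f g (x ∷ xs) = trans (cong (f x + g x +_) (sumℚ-+ f g xs))
    (solve 4 (λ a b c d → a :+ b :+ (c :+ d) := a :+ c :+ (b :+ d)) refl
      (f x) (g x) (sumℚ (map f xs)) (sumℚ (map g xs)))

  sumℚ-*ˡ : (c : ℚ) (f : A → ℚ) (xs : List A) →
    sumℚ (map (λ x → c * f x) xs) ≡ c * sumℚ (map f xs)
  sumℚ-*ˡ c f []       = sym (ℚₚ.*-zeroʳ c)
  sumℚ-*ˡ c f (x ∷ xs) = trans (cong (c * f x +_) (sumℚ-*ˡ c f xs)) (sym (ℚₚ.*-distribˡ-+ c _ _))

  sumℚ-concatMap : (f : B → ℚ) (g : A → List B) (xs : List A) →
    sumℚ (map f (concatMap g xs)) ≡ sumℚ (map (λ x → sumℚ (map f (g x))) xs)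
  sumℚ-concatMap f g []       = refl
  sumℚ-concatMap f g (x ∷ xs) =
    trans (sumℚ-++ f (g x) (concatMap g xs)) (cong (sumℚ (map f (g x)) +_) (sumℚ-concatMap f g xs))

  -- altExpand F (x₀ ∷ ⋯ ∷ xₙ) = Σᵢ (-1)ⁱ F xᵢ (the vector without xᵢ), see altExpand-lookup.
  altExpand : ∀ {n} → (A → Vec A n → ℚ) → Vec A (suc n) → ℚ
  altExpand {n = zero}  F (x ∷ []) = F x []
  altExpand {n = suc n} F (x ∷ xs) = F x xs - altExpand (λ y ys → F y (x ∷ ys)) xs

  altExpand-cong : ∀ {n} {F G : A → Vec A n → ℚ} → (∀ t r → F t r ≡ G t r) →
    ∀ w → altExpand F w ≡ altExpand G w
  altExpand-cong {n = zero}  F≗G (x ∷ [])  = F≗G x []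
  altExpand-cong {n = suc n} F≗G (x ∷ xs) =
    cong₂ _-_ (F≗G x xs) (altExpand-cong (λ y ys → F≗G y (x ∷ ys)) xs)

  altExpand-zero : ∀ {n} {F : A → Vec A n → ℚ} → (∀ t r → F t r ≡ 0ℚ) → ∀ w → altExpand F w ≡ 0ℚ
  altExpand-zero {n = zero}  F≗0 (x ∷ [])  = F≗0 x []
  altExpand-zero {n = suc n} F≗0 (x ∷ xs) =
    cong₂ _-_ (F≗0 x xs) (altExpand-zero (λ y ys → F≗0 y (x ∷ ys)) xs)

  altExpand-+ : ∀ {n} (F G : A → Vec A n → ℚ) w →
    altExpand (λ t r → F t r + G t r) w ≡ altExpand F w + altExpand G w
  altExpand-+ {n = zero}  F G (x ∷ [])  = refl
  altExpand-+ {n = suc n} F G (x ∷ xs) =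
    trans (cong (λ z → F x xs + G x xs - z) (altExpand-+ _ _ xs))
      (solve 4 (λ a b c d → a :+ b :- (c :+ d) := a :- c :+ (b :- d)) refl
        (F x xs) (G x xs) (altExpand (λ y ys → F y (x ∷ ys)) xs) (altExpand (λ y ys → G y (x ∷ ys)) xs))

  altExpand-- : ∀ {n} (F G : A → Vec A n → ℚ) w →
    altExpand (λ t r → F t r - G t r) w ≡ altExpand F w - altExpand G w
  altExpand-- {n = zero}  F G (x ∷ [])  = refl
  altExpand-- {n = suc n} F G (x ∷ xs) =
    trans (cong (λ z → F x xs - G x xs - z) (altExpand-- _ _ xs))
      (solve 4 (λ a b c d → a :- b :- (c :- d) := a :- c :- (b :- d)) refl
        (F x xs) (G x xs) (altExpand (λ y ys → F y (x ∷ ys)) xs) (altExpand (λ y ys → G y (x ∷ ys)) xs))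

  altExpand-*ˡ : ∀ {n} (c : ℚ) (F : A → Vec A n → ℚ) w →
    altExpand (λ t r → c * F t r) w ≡ c * altExpand F w
  altExpand-*ˡ {n = zero}  c F (x ∷ [])  = refl
  altExpand-*ˡ {n = suc n} c F (x ∷ xs) =
    trans (cong (λ z → c * F x xs - z) (altExpand-*ˡ c _ xs))
      (solve 3 (λ c a b → c :* a :- c :* b := c :* (a :- b)) refl
        c (F x xs) (altExpand (λ y ys → F y (x ∷ ys)) xs))

  altExpand-swap : ∀ {n} (G : A → A → Vec A n → ℚ) w →
    altExpand (λ t → altExpand (G t)) w ≡ - altExpand (λ u → altExpand (λ t → G t u)) w
  altExpand-swap {n = zero}  G (x ∷ y ∷ []) =
    solve 2 (λ a b → a :- b := :- (b :- a)) refl (G x y []) (G y x [])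
  altExpand-swap {A = A} {n = suc n} G (x ∷ xs) = begin
      a - altExpand (λ t r → altExpand (G t) (x ∷ r)) xs
    ≡⟨ cong (λ z → a - z) (altExpand-- (λ t → G t x) (λ t → altExpand (G′ t)) xs) ⟩
      a - (b - altExpand (λ t → altExpand (G′ t)) xs)
    ≡⟨ cong (λ z → a - (b - z)) (altExpand-swap G′ xs) ⟩
      a - (b - - c)
    ≡⟨ solve 3 (λ a b c → a :- (b :- :- c) := :- (b :- (a :- c))) refl a b c ⟩
      - (b - (a - c))
    ≡⟨ cong (λ z → - (b - z)) (altExpand-- (G x) (λ u → altExpand (λ t → G′ t u)) xs) ⟨
      - altExpand (λ u → altExpand (λ t → G t u)) (x ∷ xs)
    ∎
    where
    G′ : A → A → Vec A n → ℚ
    G′ t u r = G t u (x ∷ r)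
    a b c : ℚ
    a = altExpand (G x) xs
    b = altExpand (λ t → G t x) xs
    c = altExpand (λ u → altExpand (λ t → G′ t u)) xs

  altExpand-nested-swap : ∀ {n} (φ ψ : A → ℚ) (g : Vec A n → ℚ) w →
    altExpand (λ t r → φ t * altExpand (λ u r′ → ψ u * g r′) r) w ≡
    - altExpand (λ u r → ψ u * altExpand (λ t r′ → φ t * g r′) r) w
  altExpand-nested-swap φ ψ g w = begin
      altExpand (λ t r → φ t * altExpand (λ u r′ → ψ u * g r′) r) w
    ≡⟨ altExpand-cong (λ t r → altExpand-*ˡ (φ t) (λ u r′ → ψ u * g r′) r) w ⟨
      altExpand (λ t → altExpand (λ u r′ → φ t * (ψ u * g r′))) w
    ≡⟨ altExpand-swap (λ t u r′ → φ t * (ψ u * g r′)) w ⟩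
      - altExpand (λ u → altExpand (λ t r′ → φ t * (ψ u * g r′))) w
    ≡⟨ cong -_ (altExpand-cong (λ u r → trans (altExpand-cong (λ t r′ → exchange (φ t) (ψ u) (g r′)) r)
                                            (altExpand-*ˡ (ψ u) (λ t r′ → φ t * g r′) r)) w) ⟩
      - altExpand (λ u r → ψ u * altExpand (λ t r′ → φ t * g r′) r) w
    ∎
    where
    exchange : ∀ x y z → x * (y * z) ≡ y * (x * z)
    exchange = solve 3 (λ x y z → x :* (y :* z) := y :* (x :* z)) refl

  x≡-x⇒x≡0 : ∀ x → x ≡ - x → x ≡ 0ℚ
  x≡-x⇒x≡0 x x≡-x = begin
    x                  ≡⟨ solve 1 (λ x → x := con ℚ.½ :* (x :+ x)) refl x ⟩
    ℚ.½ * (x + x)      ≡⟨ cong (λ z → ℚ.½ * (x + z)) x≡-x ⟩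
    ℚ.½ * (x + - x)    ≡⟨ solve 1 (λ x → con ℚ.½ :* (x :+ :- x) := con 0ℚ) refl x ⟩
    0ℚ                 ∎

  -- The summand is symmetric in the two removed entries, while altExpand-swap makes the sum antisymmetric.
  altExpand-nested-≡0 : ∀ {n} (φ : A → ℚ) (g : Vec A n → ℚ) w →
    altExpand (λ t r → φ t * altExpand (λ u r′ → φ u * g r′) r) w ≡ 0ℚ
  altExpand-nested-≡0 φ g w = x≡-x⇒x≡0 _ (altExpand-nested-swap φ φ g w)

  parity : ℕ → ℚ
  parity zero    = 0ℚ
  parity (suc n) = 1ℚ - parity n

  parity-odd : ∀ n → n % 2 ≡ 1 → parity n ≡ 1ℚ
  parity-odd (suc zero)    _   = refl
  parity-odd (suc (suc n)) odd =
    trans (solve 1 (λ x → con 1ℚ :- (con 1ℚ :- x) := x) refl (parity n)) (parity-odd n odd)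

  module _ (f : ℕ → A → ℚ) where

    powerSum : ℕ → A → ℚ
    powerSum zero    t = 0ℚ
    powerSum (suc K) t = powerSum K t + f K t

    -- alternatingSum f n K w = Σ_{σ ∈ Sₙ} sgn σ Σ_{K > k₁ > ⋯ > kₙ ≥ 0} Πᵢ f kᵢ w_{σ(i)}, split by k₁.
    alternatingSum : (n : ℕ) → ℕ → Vec A n → ℚ
    alternatingSum zero    K       [] = 1ℚ
    alternatingSum (suc n) zero    w  = 0ℚ
    alternatingSum (suc n) (suc K) w  =
      alternatingSum (suc n) K w + altExpand (λ t r → f K t * alternatingSum n K r) w

    altExpand-powerSum : ∀ K n w →
      altExpand (λ t r → powerSum K t * alternatingSum n K r) w ≡ parity (suc n) * alternatingSum (suc n) K w
    altExpand-powerSum zero n w =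
      trans (altExpand-zero (λ t r → ℚₚ.*-zeroˡ (alternatingSum n zero r)) w) (sym (ℚₚ.*-zeroʳ (parity (suc n))))
    altExpand-powerSum (suc K) zero (x ∷ []) = begin
        (powerSum K x + f K x) * 1ℚ
      ≡⟨ ℚₚ.*-distribʳ-+ 1ℚ (powerSum K x) (f K x) ⟩
        powerSum K x * 1ℚ + f K x * 1ℚ
      ≡⟨ cong (_+ f K x * 1ℚ) (altExpand-powerSum K zero (x ∷ [])) ⟩
        (1ℚ - 0ℚ) * alternatingSum 1 K (x ∷ []) + f K x * 1ℚ
      ≡⟨ solve 2 (λ d e → (con 1ℚ :- con 0ℚ) :* d :+ e := (con 1ℚ :- con 0ℚ) :* (d :+ e)) refl
           (alternatingSum 1 K (x ∷ [])) (f K x * 1ℚ) ⟩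
        (1ℚ - 0ℚ) * alternatingSum 1 (suc K) (x ∷ [])
      ∎
    altExpand-powerSum (suc K) (suc n) w = begin
        altExpand (λ t r → (P t + f K t) * (D r + δ r)) w
      ≡⟨ altExpand-cong (λ t r → distrib (P t) (f K t) (D r) (δ r)) w ⟩
        altExpand (λ t r → (P t * D r + f K t * D r) + (P t * δ r + f K t * δ r)) w
      ≡⟨ altExpand-+ _ _ w ⟩
        altExpand (λ t r → P t * D r + f K t * D r) w + altExpand (λ t r → P t * δ r + f K t * δ r) w
      ≡⟨ cong₂ _+_ (altExpand-+ _ _ w) (altExpand-+ _ _ w) ⟩
        (altExpand (λ t r → P t * D r) w + S) + (altExpand (λ t r → P t * δ r) w + altExpand (λ t r → f K t * δ r) w)
      ≡⟨ cong₂ (λ a b → (a + S) + b) (altExpand-powerSum K (suc n) w) (cong₂ _+_ cross vanish) ⟩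
        (parity (suc (suc n)) * D′ + S) + (- (parity (suc n) * S) + 0ℚ)
      ≡⟨ solve 3 (λ q d s → ((con 1ℚ :- q) :* d :+ s) :+ (:- (q :* s) :+ con 0ℚ) := (con 1ℚ :- q) :* (d :+ s)) refl
           (parity (suc n)) D′ S ⟩
        parity (suc (suc n)) * (D′ + S)
      ∎
      where
      P : A → ℚ
      P = powerSum K
      D : Vec A (suc n) → ℚ
      D = alternatingSum (suc n) K
      δ : Vec A (suc n) → ℚ
      δ = altExpand (λ t r → f K t * alternatingSum n K r)
      D′ S : ℚ
      D′ = alternatingSum (suc (suc n)) K w
      S = altExpand (λ t r → f K t * D r) w
      distrib : ∀ a b c d → (a + b) * (c + d) ≡ (a * c + b * c) + (a * d + b * d)
      distrib = solve 4 (λ a b c d → (a :+ b) :* (c :+ d) := (a :* c :+ b :* c) :+ (a :* d :+ b :* d)) refl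
      cross : altExpand (λ t r → P t * δ r) w ≡ - (parity (suc n) * S)
      cross = begin
          altExpand (λ t r → P t * δ r) w
        ≡⟨ altExpand-nested-swap P (f K) (alternatingSum n K) w ⟩
          - altExpand (λ u r → f K u * altExpand (λ t r′ → P t * alternatingSum n K r′) r) w
        ≡⟨ cong -_ (altExpand-cong (λ u r → cong (f K u *_) (altExpand-powerSum K n r)) w) ⟩
          - altExpand (λ u r → f K u * (parity (suc n) * D r)) w
        ≡⟨ cong -_ (altExpand-cong (λ u r → solve 3 (λ a b c → a :* (b :* c) := b :* (a :* c)) refl
                                               (f K u) (parity (suc n)) (D r)) w) ⟩
          - altExpand (λ u r → parity (suc n) * (f K u * D r)) w
        ≡⟨ cong -_ (altExpand-*ˡ (parity (suc n)) (λ u r → f K u * D r) w) ⟩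
          - (parity (suc n) * S)
        ∎
      vanish : altExpand (λ t r → f K t * δ r) w ≡ 0ℚ
      vanish = altExpand-nested-≡0 (f K) (alternatingSum n K) w

-- Enumerating the symmetric group

module _ where
  open import Data.Fin using (zero; suc; punchIn)
  open import Data.Fin.Properties using (_≟_; punchIn-injective; punchInᵢ≢i)
  import Data.Vec as Vec
  open import Data.Vec.Properties using (toList-map)
  open import Data.List using (filter; allFin)
  open import Data.List.Properties
    using ( filter-++; filter-≐; filter-none; filter-accept; filter-reject
          ; map-∘; map-tabulate; map-concatMap; concatMap-map; concatMap-cong)
  open import Data.List.Relation.Unary.All as All using (All; []; _∷_; all?)
  open import Data.List.Relation.Unary.AllPairs using (_∷_)
  open import Data.List.Relation.Unary.Unique.Propositional using (Unique)
  import Data.List.Relation.Unary.Unique.Propositional.Properties as Unique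
  open import Data.List.Relation.Unary.Unique.DecPropositional using (unique?)
  open import Data.Product using (_,_)
  open import Relation.Nullary using (yes; no; does; ¬?)
  open import Relation.Nullary.Decidable using (_×-dec_)
  open import Relation.Unary using (Pred; Decidable)
  open import Level using (0ℓ)
  open import Function using (_∘_)
  open import Data.Bool using (true; false)
  open ≡-Reasoning

  module _ {P : Pred B 0ℓ} (P? : Decidable P) where

    filter-map : (f : A → B) (xs : List A) → filter P? (map f xs) ≡ map f (filter (P? ∘ f) xs)
    filter-map f []       = refl
    filter-map f (x ∷ xs) with does (P? (f x))
    ... | true  = cong (f x ∷_) (filter-map f xs)
    ... | false = filter-map f xs

    filter-concatMap : (g : A → List B) (xs : List A) →
      filter P? (concatMap g xs) ≡ concatMap (filter P? ∘ g) xs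
    filter-concatMap g []       = refl
    filter-concatMap g (x ∷ xs) =
      trans (filter-++ P? (g x) (concatMap g xs)) (cong (filter P? (g x) ++_) (filter-concatMap g xs))

    filter-filter : {Q : Pred B 0ℓ} (Q? : Decidable Q) (xs : List B) →
      filter P? (filter Q? xs) ≡ filter (λ x → Q? x ×-dec P? x) xs
    filter-filter Q? []       = refl
    filter-filter Q? (x ∷ xs) with Q? x | P? x
    ... | yes _ | yes Px = trans (filter-accept P? Px) (cong (x ∷_) (filter-filter Q? xs))
    ... | yes _ | no ¬Px = trans (filter-reject P? ¬Px) (filter-filter Q? xs)
    ... | no  _ | _      = filter-filter Q? xs

  allFin-suc : ∀ n → allFin (suc n) ≡ zero ∷ map suc (allFin n)
  allFin-suc n = cong (zero ∷_) (sym (map-tabulate (λ i → i) suc))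

  concatMap-allFin-punchIn : ∀ {n} (i : Fin (suc n)) (g : Fin (suc n) → List A) → g i ≡ [] →
    concatMap g (allFin (suc n)) ≡ concatMap (g ∘ punchIn i) (allFin n)
  concatMap-allFin-punchIn {n = n} zero g gi≡[] = begin
    concatMap g (allFin (suc n))            ≡⟨ cong (concatMap g) (allFin-suc n) ⟩
    g zero ++ concatMap g (map suc (allFin n)) ≡⟨ cong₂ _++_ gi≡[] (concatMap-map g suc (allFin n)) ⟩
    concatMap (g ∘ suc) (allFin n)          ∎
  concatMap-allFin-punchIn {n = suc n} (suc i) g gi≡[] = begin
    concatMap g (allFin (suc (suc n)))
      ≡⟨ cong (concatMap g) (allFin-suc (suc n)) ⟩
    g zero ++ concatMap g (map suc (allFin (suc n)))
      ≡⟨ cong (g zero ++_) (concatMap-map g suc (allFin (suc n))) ⟩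
    g zero ++ concatMap (g ∘ suc) (allFin (suc n))
      ≡⟨ cong (g zero ++_) (concatMap-allFin-punchIn i (g ∘ suc) gi≡[]) ⟩
    g zero ++ concatMap (g ∘ suc ∘ punchIn i) (allFin n)
      ≡⟨ cong (g zero ++_) (concatMap-map (g ∘ punchIn (suc i)) suc (allFin n)) ⟨
    g zero ++ concatMap (g ∘ punchIn (suc i)) (map suc (allFin n))
      ≡⟨ cong (concatMap (g ∘ punchIn (suc i))) (allFin-suc n) ⟨
    concatMap (g ∘ punchIn (suc i)) (allFin (suc n))
      ∎

  Avoids : ∀ {m k} → Fin m → Vec (Fin m) k → Set
  Avoids i v = All (i ≢_) (Vec.toList v)

  avoids? : ∀ {m k} (i : Fin m) → Decidable (Avoids {k = k} i)
  avoids? i v = all? (λ j → ¬? (i ≟ j)) (Vec.toList v)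

  filter-avoids-allVecs : ∀ {n} (i : Fin (suc n)) k →
    filter (avoids? i) (allVecs (suc n) k) ≡ map (Vec.map (punchIn i)) (allVecs n k)
  filter-avoids-allVecs i zero = refl
  filter-avoids-allVecs {n} i (suc k) = begin
      filter (avoids? i) (concatMap (λ a → map (a ∷_) (allVecs (suc n) k)) (allFin (suc n)))
    ≡⟨ filter-concatMap (avoids? i) (λ a → map (a ∷_) (allVecs (suc n) k)) (allFin (suc n)) ⟩
      concatMap (λ a → filter (avoids? i) (map (a ∷_) (allVecs (suc n) k))) (allFin (suc n))
    ≡⟨ concatMap-cong (λ a → filter-map (avoids? i) (a ∷_) (allVecs (suc n) k)) (allFin (suc n)) ⟩
      concatMap g (allFin (suc n))
    ≡⟨ concatMap-allFin-punchIn i g gi≡[] ⟩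
      concatMap (g ∘ punchIn i) (allFin n)
    ≡⟨ concatMap-cong g∘punchIn (allFin n) ⟩
      concatMap (λ b → map (Vec.map (punchIn i)) (map (b ∷_) (allVecs n k))) (allFin n)
    ≡⟨ map-concatMap (Vec.map (punchIn i)) (λ b → map (b ∷_) (allVecs n k)) (allFin n) ⟨
      map (Vec.map (punchIn i)) (allVecs n (suc k))
    ∎
    where
    g : Fin (suc n) → List (Vec (Fin (suc n)) (suc k))
    g a = map (a ∷_) (filter (λ v → avoids? i (a ∷ v)) (allVecs (suc n) k))
    gi≡[] : g i ≡ []
    gi≡[] = cong (map (i ∷_)) (filter-none (λ v → avoids? i (i ∷ v))
                (All.universal (λ { v (i≢i ∷ _) → i≢i refl }) (allVecs (suc n) k)))
    g∘punchIn : ∀ b → g (punchIn i b) ≡ map (Vec.map (punchIn i)) (map (b ∷_) (allVecs n k))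
    g∘punchIn b = begin
        map (punchIn i b ∷_) (filter (λ v → avoids? i (punchIn i b ∷ v)) (allVecs (suc n) k))
      ≡⟨ cong (map (punchIn i b ∷_)) (filter-≐ (λ v → avoids? i (punchIn i b ∷ v)) (avoids? i)
           ((λ { (_ ∷ a) → a }) , (λ a → (λ e → punchInᵢ≢i i b (sym e)) ∷ a)) (allVecs (suc n) k)) ⟩
        map (punchIn i b ∷_) (filter (avoids? i) (allVecs (suc n) k))
      ≡⟨ cong (map (punchIn i b ∷_)) (filter-avoids-allVecs i k) ⟩
        map (punchIn i b ∷_) (map (Vec.map (punchIn i)) (allVecs n k))
      ≡⟨ trans (sym (map-∘ (allVecs n k))) (map-∘ (allVecs n k)) ⟩
        map (Vec.map (punchIn i)) (map (b ∷_) (allVecs n k))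
      ∎

  extend : ∀ {n} → Fin (suc n) → Vec (Fin n) n → Vec (Fin (suc n)) (suc n)
  extend i τ = i ∷ Vec.map (punchIn i) τ

  permutations-suc : ∀ n →
    permutations (suc n) ≡ concatMap (λ i → map (extend i) (permutations n)) (allFin (suc n))
  permutations-suc n =
    trans (filter-concatMap distinct? (λ i → map (i ∷_) (allVecs (suc n) n)) (allFin (suc n)))
          (concatMap-cong filter-distinct-cons (allFin (suc n)))
    where
    distinct? : ∀ {m k} → Decidable (λ (v : Vec (Fin m) k) → Unique (Vec.toList v))
    distinct? v = unique? _≟_ (Vec.toList v)
    distinct-map-punchIn : ∀ i (v : Vec (Fin n) n) →
      Unique (Vec.toList (Vec.map (punchIn i) v)) → Unique (Vec.toList v)
    distinct-map-punchIn i v u = Unique.map⁻ (subst Unique (toList-map (punchIn i) v) u)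
    map-punchIn-distinct : ∀ i (v : Vec (Fin n) n) →
      Unique (Vec.toList v) → Unique (Vec.toList (Vec.map (punchIn i) v))
    map-punchIn-distinct i v u =
      subst Unique (sym (toList-map (punchIn i) v)) (Unique.map⁺ (punchIn-injective i _ _) u)
    filter-distinct-cons : ∀ i → filter distinct? (map (i ∷_) (allVecs (suc n) n)) ≡ map (extend i) (permutations n)
    filter-distinct-cons i = begin
        filter distinct? (map (i ∷_) (allVecs (suc n) n))
      ≡⟨ filter-map distinct? (i ∷_) (allVecs (suc n) n) ⟩
        map (i ∷_) (filter (λ v → distinct? (i ∷ v)) (allVecs (suc n) n))
      ≡⟨ cong (map (i ∷_)) (filter-≐ (λ v → distinct? (i ∷ v)) (λ v → avoids? i v ×-dec distinct? v)
           ((λ { (a ∷ u) → a , u }) , (λ { (a , u) → a ∷ u })) (allVecs (suc n) n)) ⟩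
        map (i ∷_) (filter (λ v → avoids? i v ×-dec distinct? v) (allVecs (suc n) n))
      ≡⟨ cong (map (i ∷_)) (filter-filter distinct? (avoids? i) (allVecs (suc n) n)) ⟨
        map (i ∷_) (filter distinct? (filter (avoids? i) (allVecs (suc n) n)))
      ≡⟨ cong (map (i ∷_) ∘ filter distinct?) (filter-avoids-allVecs i n) ⟩
        map (i ∷_) (filter distinct? (map (Vec.map (punchIn i)) (allVecs n n)))
      ≡⟨ cong (map (i ∷_)) (filter-map distinct? (Vec.map (punchIn i)) (allVecs n n)) ⟩
        map (i ∷_) (map (Vec.map (punchIn i)) (filter (distinct? ∘ Vec.map (punchIn i)) (allVecs n n)))
      ≡⟨ cong (map (i ∷_) ∘ map (Vec.map (punchIn i))) (filter-≐ (distinct? ∘ Vec.map (punchIn i)) distinct?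
           ((λ {v} → distinct-map-punchIn i v) , (λ {v} → map-punchIn-distinct i v)) (allVecs n n)) ⟩
        map (i ∷_) (map (Vec.map (punchIn i)) (permutations n))
      ≡⟨ map-∘ (permutations n) ⟨
        map (extend i) (permutations n)
      ∎

-- Signs of permutations

module _ where
  open import Data.Nat using (_<_; _≤_; _+_; _<?_; z≤n; s≤s; s≤s⁻¹)
  open import Data.Nat.Properties
    using (≤-refl; ≤-trans; <⇒≤; <⇒≱; ≮⇒≥; ≰⇒>; <-≤-trans; m<n⇒m<1+n; <-≤-connex)
  open import Data.Fin using (zero; suc; toℕ; punchIn)
  open import Data.Fin.Properties using (punchIn-mono-≤; punchIn-cancel-≤; toℕ≤pred[n])
  import Data.Vec as Vec
  open import Data.Vec.Properties using (lookup-map)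
  open import Data.List using (filter; allFin; length)
  open import Data.Nat.ListAction using (sum)
  open import Data.List.Properties using (filter-++; filter-≐; filter-accept; filter-reject; length-++; length-map; map-∘; map-cong)
  open import Data.List.Relation.Unary.All as All using (All; []; _∷_)
  open import Data.List.Relation.Unary.All.Properties using (concat⁺; map⁺)
  open import Data.Product using (_×_; _,_; proj₁; proj₂)
  open import Data.Sum using (inj₁; inj₂)
  open import Relation.Nullary using (¬_; yes; no; contradiction)
  open import Relation.Nullary.Decidable using (_×-dec_)
  open import Relation.Unary using (Pred; Decidable)
  open import Level using (0ℓ)
  open import Function using (_∘_)
  open ≡-Reasoning

  count : {P : Pred A 0ℓ} → Decidable P → List A → ℕ
  count P? = length ∘ filter P?

  count-map : {P : Pred B 0ℓ} (P? : Decidable P) (f : A → B) (xs : List A) →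
    count P? (map f xs) ≡ count (P? ∘ f) xs
  count-map P? f xs = trans (cong length (filter-map P? f xs)) (length-map f (filter (P? ∘ f) xs))

  count-concatMap : {P : Pred B 0ℓ} (P? : Decidable P) (g : A → List B) (xs : List A) →
    count P? (concatMap g xs) ≡ sum (map (count P? ∘ g) xs)
  count-concatMap P? g []       = refl
  count-concatMap P? g (x ∷ xs) = trans (cong length (filter-++ P? (g x) (concatMap g xs)))
    (trans (length-++ (filter P? (g x))) (cong (count P? (g x) +_) (count-concatMap P? g xs)))

  count-≐ : {P Q : Pred A 0ℓ} (P? : Decidable P) (Q? : Decidable Q) → (∀ x → P x → Q x) → (∀ x → Q x → P x) →
    (xs : List A) → count P? xs ≡ count Q? xs
  count-≐ P? Q? P⇒Q Q⇒P = cong length ∘ filter-≐ P? Q? ((λ {x} → P⇒Q x) , (λ {x} → Q⇒P x))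

  countBelow : ∀ {m k} → Vec (Fin m) k → ℕ → ℕ
  countBelow {k = k} v c = count (λ j → toℕ (lookup v j) <? c) (allFin k)

  inverted? : ∀ {m k} (σ : Vec (Fin m) k) (a : Fin k) →
    Decidable (λ b → toℕ a < toℕ b × toℕ (lookup σ b) < toℕ (lookup σ a))
  inverted? σ a b = (toℕ a <? toℕ b) ×-dec (toℕ (lookup σ b) <? toℕ (lookup σ a))

  inversionsOf : ∀ {m k} → Vec (Fin m) k → ℕ
  inversionsOf {k = k} σ = sum (map (λ a → count (inverted? σ a) (allFin k)) (allFin k))

  inversions≡inversionsOf : ∀ {n} (σ : Vec (Fin n) n) → inversions σ ≡ inversionsOf σ
  inversions≡inversionsOf {n} σ = begin
      length (filter (λ ij → toℕ (lookup σ (proj₂ ij)) <? toℕ (lookup σ (proj₁ ij)))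
                     (filter (λ ij → toℕ (proj₁ ij) <? toℕ (proj₂ ij)) pairs))
    ≡⟨ cong length (filter-filter (λ ij → toℕ (lookup σ (proj₂ ij)) <? toℕ (lookup σ (proj₁ ij)))
                                  (λ ij → toℕ (proj₁ ij) <? toℕ (proj₂ ij)) pairs) ⟩
      count (λ ij → inverted? σ (proj₁ ij) (proj₂ ij)) pairs
    ≡⟨ count-concatMap (λ ij → inverted? σ (proj₁ ij) (proj₂ ij)) (λ a → map (a ,_) (allFin n)) (allFin n) ⟩
      sum (map (λ a → count (λ ij → inverted? σ (proj₁ ij) (proj₂ ij)) (map (a ,_) (allFin n))) (allFin n))
    ≡⟨ cong sum (map-cong (λ a → count-map (λ ij → inverted? σ (proj₁ ij) (proj₂ ij)) (a ,_) (allFin n)) (allFin n)) ⟩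
      inversionsOf σ
    ∎
    where
    pairs : List (Fin n × Fin n)
    pairs = concatMap (λ a → map (a ,_) (allFin n)) (allFin n)

  inversionsOf-∷ : ∀ {m k} (x : Fin m) (xs : Vec (Fin m) k) →
    inversionsOf (x ∷ xs) ≡ countBelow xs (toℕ x) + inversionsOf xs
  inversionsOf-∷ {k = k} x xs = begin
      sum (map F (allFin (suc k)))
    ≡⟨ cong (sum ∘ map F) (allFin-suc k) ⟩
      F zero + sum (map F (map suc (allFin k)))
    ≡⟨ cong₂ _+_ F-zero (trans (cong sum (sym (map-∘ (allFin k)))) (cong sum (map-cong F-suc (allFin k)))) ⟩
      countBelow xs (toℕ x) + inversionsOf xs
    ∎
    where
    F : Fin (suc k) → ℕ
    F a = count (inverted? (x ∷ xs) a) (allFin (suc k))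
    F-zero : F zero ≡ countBelow xs (toℕ x)
    F-zero = trans (cong (count (inverted? (x ∷ xs) zero)) (allFin-suc k))
      (trans (count-map (inverted? (x ∷ xs) zero) suc (allFin k))
        (count-≐ _ _ (λ _ → proj₂) (λ _ lt → s≤s z≤n , lt) (allFin k)))
    F-suc : ∀ a → F (suc a) ≡ count (inverted? xs a) (allFin k)
    F-suc a = trans (cong (count (inverted? (x ∷ xs) (suc a))) (allFin-suc k))
      (trans (count-map (inverted? (x ∷ xs) (suc a)) suc (allFin k))
        (count-≐ _ _ (λ _ (lt , inv) → s≤s⁻¹ lt , inv) (λ _ (lt , inv) → s≤s lt , inv) (allFin k)))

  module _ {n : ℕ} (i : Fin (suc n)) where

    toℕ-punchIn-< : ∀ (a : Fin n) → toℕ a < toℕ i → toℕ (punchIn i a) ≡ toℕ a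
    toℕ-punchIn-< = go i
      where
      go : ∀ {n} (i : Fin (suc n)) (a : Fin n) → toℕ a < toℕ i → toℕ (punchIn i a) ≡ toℕ a
      go (suc i) zero    _          = refl
      go (suc i) (suc a) (s≤s a<i) = cong suc (go i a a<i)

    toℕ-punchIn-≥ : ∀ (a : Fin n) → toℕ i ≤ toℕ a → toℕ (punchIn i a) ≡ suc (toℕ a)
    toℕ-punchIn-≥ = go i
      where
      go : ∀ {n} (i : Fin (suc n)) (a : Fin n) → toℕ i ≤ toℕ a → toℕ (punchIn i a) ≡ suc (toℕ a)
      go zero    a       _          = refl
      go (suc i) (suc a) (s≤s i≤a) = cong suc (go i a i≤a)

    punchIn-mono-< : ∀ (a b : Fin n) → toℕ a < toℕ b → toℕ (punchIn i a) < toℕ (punchIn i b)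
    punchIn-mono-< a b a<b = ≰⇒> (λ pb≤pa → <⇒≱ a<b (punchIn-cancel-≤ i b a pb≤pa))

    punchIn-cancel-< : ∀ (a b : Fin n) → toℕ (punchIn i a) < toℕ (punchIn i b) → toℕ a < toℕ b
    punchIn-cancel-< a b pa<pb = ≰⇒> (λ b≤a → <⇒≱ pa<pb (punchIn-mono-≤ i b a b≤a))

    lookup-map-punchIn : ∀ {k} (τ : Vec (Fin n) k) j →
      toℕ (lookup (Vec.map (punchIn i) τ) j) ≡ toℕ (punchIn i (lookup τ j))
    lookup-map-punchIn τ j = cong toℕ (lookup-map j (punchIn i) τ)

    inversionsOf-map-punchIn : ∀ {k} (τ : Vec (Fin n) k) → inversionsOf (Vec.map (punchIn i) τ) ≡ inversionsOf τ
    inversionsOf-map-punchIn {k} τ = cong sum (map-cong (λ a → count-≐ _ _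
        (λ b (a<b , inv) → a<b , punchIn-cancel-< (lookup τ b) (lookup τ a)
                                   (subst₂ _<_ (lookup-map-punchIn τ b) (lookup-map-punchIn τ a) inv))
        (λ b (a<b , inv) → a<b , subst₂ _<_ (sym (lookup-map-punchIn τ b)) (sym (lookup-map-punchIn τ a))
                                   (punchIn-mono-< (lookup τ b) (lookup τ a) inv))
        (allFin k)) (allFin k))

    countBelow-map-punchIn-≤ : ∀ {k} (τ : Vec (Fin n) k) c → c ≤ toℕ i →
      countBelow (Vec.map (punchIn i) τ) c ≡ countBelow τ c
    countBelow-map-punchIn-≤ {k} τ c c≤i = count-≐ _ _ below below⁻¹ (allFin k)
      where
      below : ∀ j → toℕ (lookup (Vec.map (punchIn i) τ) j) < c → toℕ (lookup τ j) < c
      below j lt with <-≤-connex (toℕ (lookup τ j)) (toℕ i)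
      ... | inj₁ a<i = subst (_< c) (trans (lookup-map-punchIn τ j) (toℕ-punchIn-< _ a<i)) lt
      ... | inj₂ i≤a = contradiction (≤-trans c≤i i≤a)
                         (<⇒≱ (<⇒≤ (subst (_< c) (trans (lookup-map-punchIn τ j) (toℕ-punchIn-≥ _ i≤a)) lt)))
      below⁻¹ : ∀ j → toℕ (lookup τ j) < c → toℕ (lookup (Vec.map (punchIn i) τ) j) < c
      below⁻¹ j lt = subst (_< c)
        (sym (trans (lookup-map-punchIn τ j) (toℕ-punchIn-< _ (<-≤-trans lt c≤i)))) lt

    countBelow-map-punchIn-≥ : ∀ {k} (τ : Vec (Fin n) k) c → toℕ i ≤ c →
      countBelow (Vec.map (punchIn i) τ) (suc c) ≡ countBelow τ c
    countBelow-map-punchIn-≥ {k} τ c i≤c = count-≐ _ _ below below⁻¹ (allFin k)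
      where
      below : ∀ j → toℕ (lookup (Vec.map (punchIn i) τ) j) < suc c → toℕ (lookup τ j) < c
      below j lt with <-≤-connex (toℕ (lookup τ j)) (toℕ i)
      ... | inj₁ a<i = <-≤-trans a<i i≤c
      ... | inj₂ i≤a = s≤s⁻¹ (subst (_< suc c) (trans (lookup-map-punchIn τ j) (toℕ-punchIn-≥ _ i≤a)) lt)
      below⁻¹ : ∀ j → toℕ (lookup τ j) < c → toℕ (lookup (Vec.map (punchIn i) τ) j) < suc c
      below⁻¹ j lt with <-≤-connex (toℕ (lookup τ j)) (toℕ i)
      ... | inj₁ a<i = subst (_< suc c) (sym (trans (lookup-map-punchIn τ j) (toℕ-punchIn-< _ a<i))) (m<n⇒m<1+n lt)
      ... | inj₂ i≤a = subst (_< suc c) (sym (trans (lookup-map-punchIn τ j) (toℕ-punchIn-≥ _ i≤a))) (s≤s lt)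

  countBelow-∷-< : ∀ {m k} (x : Fin m) (xs : Vec (Fin m) k) c → toℕ x < c →
    countBelow (x ∷ xs) c ≡ suc (countBelow xs c)
  countBelow-∷-< {k = k} x xs c x<c = trans (cong (count below?) (allFin-suc k))
    (trans (cong length (filter-accept below? x<c)) (cong suc (count-map below? suc (allFin k))))
    where
    below? : Decidable (λ j → toℕ (lookup (x ∷ xs) j) < c)
    below? j = toℕ (lookup (x ∷ xs) j) <? c

  countBelow-∷-≮ : ∀ {m k} (x : Fin m) (xs : Vec (Fin m) k) c → ¬ toℕ x < c →
    countBelow (x ∷ xs) c ≡ countBelow xs c
  countBelow-∷-≮ {k = k} x xs c x≮c = trans (cong (count below?) (allFin-suc k))
    (trans (cong length (filter-reject below? x≮c)) (count-map below? suc (allFin k)))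
    where
    below? : Decidable (λ j → toℕ (lookup (x ∷ xs) j) < c)
    below? j = toℕ (lookup (x ∷ xs) j) <? c

  -- Every permutation τ of Fin n has exactly c entries below c, so prepending i creates i new inversions.
  CountsBelow : ∀ {n} → Vec (Fin n) n → Set
  CountsBelow {n} τ = ∀ c → c ≤ n → countBelow τ c ≡ c

  CountsBelow-extend : ∀ {n} (i : Fin (suc n)) {τ : Vec (Fin n) n} → CountsBelow τ → CountsBelow (extend i τ)
  CountsBelow-extend i {τ} counts c c≤ with toℕ i <? c
  CountsBelow-extend i {τ} counts (suc c) c≤ | yes i<c =
    trans (countBelow-∷-< i _ (suc c) i<c)
          (cong suc (trans (countBelow-map-punchIn-≥ i τ c (s≤s⁻¹ i<c)) (counts c (s≤s⁻¹ c≤))))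
  ... | no i≮c = trans (countBelow-∷-≮ i _ c i≮c)
    (trans (countBelow-map-punchIn-≤ i τ c (≮⇒≥ i≮c)) (counts c (≤-trans (≮⇒≥ i≮c) (toℕ≤pred[n] i))))

  permutations-CountsBelow : ∀ n → All CountsBelow (permutations n)
  permutations-CountsBelow zero    = (λ { zero z≤n → refl }) ∷ []
  permutations-CountsBelow (suc n) = subst (All CountsBelow) (sym (permutations-suc n))
    (concat⁺ (map⁺ (All.universal (λ i → map⁺ (All.map (CountsBelow-extend i) (permutations-CountsBelow n)))
                                   (allFin (suc n)))))

  inversions-extend : ∀ {n} (i : Fin (suc n)) {τ : Vec (Fin n) n} → CountsBelow τ →
    inversions (extend i τ) ≡ toℕ i + inversions τ
  inversions-extend i {τ} counts = begin
    inversions (extend i τ)                                          ≡⟨ inversions≡inversionsOf (extend i τ) ⟩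
    inversionsOf (extend i τ)                                        ≡⟨ inversionsOf-∷ i (Vec.map (punchIn i) τ) ⟩
    countBelow (Vec.map (punchIn i) τ) (toℕ i) + inversionsOf (Vec.map (punchIn i) τ)
      ≡⟨ cong₂ _+_ (trans (countBelow-map-punchIn-≤ i τ (toℕ i) ≤-refl) (counts (toℕ i) (toℕ≤pred[n] i)))
                   (inversionsOf-map-punchIn i τ) ⟩
    toℕ i + inversionsOf τ                                           ≡⟨ cong (toℕ i +_) (inversions≡inversionsOf τ) ⟨
    toℕ i + inversions τ                                             ∎

-- Alternating sums of multiple harmonic sums

module _ where
  import Data.Nat as ℕ
  open import Data.Rational as ℚ using (ℚ; 0ℚ; 1ℚ; _+_; _*_; -_; _-_)
  import Data.Rational.Properties as ℚₚ
  open import Data.Rational.Solver using (module +-*-Solver)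
  open +-*-Solver
  open import Data.Fin using (zero; suc; toℕ; punchIn)
  open import Data.Fin.Properties using (punchInᵢ≢i; punchOut-punchIn)
  import Data.Vec as Vec
  open import Data.Vec using (removeAt)
  import Data.Vec.Properties as Vecₚ
  open import Data.List using (allFin; upTo)
  open import Data.List.Properties using (map-cong; map-cong-local; map-∘; applyUpTo-∷ʳ)
  import Data.List.Relation.Unary.All as All
  open import Function using (_∘_)
  open ≡-Reasoning

  negOnePow-+ : ∀ a b → negOnePow (a ℕ.+ b) ≡ negOnePow a * negOnePow b
  negOnePow-+ zero    b = sym (ℚₚ.*-identityˡ (negOnePow b))
  negOnePow-+ (suc a) b = trans (cong -_ (negOnePow-+ a b)) (ℚₚ.neg-distribˡ-* (negOnePow a) (negOnePow b))

  sgn-extend : ∀ {n} (i : Fin (suc n)) {τ : Vec (Fin n) n} → CountsBelow τ →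
    sgn (extend i τ) ≡ negOnePow (toℕ i) * sgn τ
  sgn-extend i {τ} counts = trans (cong negOnePow (inversions-extend i counts)) (negOnePow-+ (toℕ i) (inversions τ))

  lookup-removeAt : ∀ {n} (s : Vec A (suc n)) i k → lookup (removeAt s i) k ≡ lookup s (punchIn i k)
  lookup-removeAt s i k = trans (cong (lookup (removeAt s i)) (sym (punchOut-punchIn i)))
                                (Vecₚ.removeAt-punchOut s (punchInᵢ≢i i k ∘ sym))

  act-extend : ∀ {n} (i : Fin (suc n)) (τ : Vec (Fin n) n) (s : Vec ℤ (suc n)) →
    act (extend i τ) s ≡ lookup s i ∷ act τ (removeAt s i)
  act-extend i τ s = cong (λ v → lookup s i ∷ Vec.toList v)
    (trans (sym (Vecₚ.map-∘ (lookup s) (punchIn i) τ)) (Vecₚ.map-cong (λ k → sym (lookup-removeAt s i k)) τ))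

  altExpand-lookup : ∀ {n} (F : A → Vec A n → ℚ) (s : Vec A (suc n)) →
    altExpand F s ≡ sumℚ (map (λ i → negOnePow (toℕ i) * F (lookup s i) (removeAt s i)) (allFin (suc n)))
  altExpand-lookup {n = zero}  F (x ∷ []) = solve 1 (λ a → a := con 1ℚ :* a :+ con 0ℚ) refl (F x [])
  altExpand-lookup {A = A} {n = suc n} F (x ∷ y ∷ ys) = begin
      F x (y ∷ ys) - altExpand F′ (y ∷ ys)
    ≡⟨ cong (λ z → F x (y ∷ ys) - z) (altExpand-lookup F′ (y ∷ ys)) ⟩
      F x (y ∷ ys) - sumℚ (map term′ (allFin (suc n)))
    ≡⟨ solve 2 (λ a b → a :- b := con 1ℚ :* a :+ (:- con 1ℚ) :* b) refl
         (F x (y ∷ ys)) (sumℚ (map term′ (allFin (suc n)))) ⟩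
      1ℚ * F x (y ∷ ys) + (- 1ℚ) * sumℚ (map term′ (allFin (suc n)))
    ≡⟨ cong (1ℚ * F x (y ∷ ys) +_) (sumℚ-*ˡ (- 1ℚ) term′ (allFin (suc n))) ⟨
      1ℚ * F x (y ∷ ys) + sumℚ (map (λ i → - 1ℚ * term′ i) (allFin (suc n)))
    ≡⟨ cong (1ℚ * F x (y ∷ ys) +_) (cong sumℚ (map-cong -term′≡term∘suc (allFin (suc n)))) ⟩
      1ℚ * F x (y ∷ ys) + sumℚ (map (term ∘ suc) (allFin (suc n)))
    ≡⟨ cong (1ℚ * F x (y ∷ ys) +_) (cong sumℚ (map-∘ {g = term} {f = suc} (allFin (suc n)))) ⟩
      sumℚ (map term (zero ∷ map suc (allFin (suc n))))
    ≡⟨ cong (sumℚ ∘ map term) (allFin-suc (suc n)) ⟨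
      sumℚ (map term (allFin (suc (suc n))))
    ∎
    where
    F′ : A → Vec A n → ℚ
    F′ t r = F t (x ∷ r)
    term : Fin (suc (suc n)) → ℚ
    term i = negOnePow (toℕ i) * F (lookup (x ∷ y ∷ ys) i) (removeAt (x ∷ y ∷ ys) i)
    term′ : Fin (suc n) → ℚ
    term′ i = negOnePow (toℕ i) * F′ (lookup (y ∷ ys) i) (removeAt (y ∷ ys) i)
    -term′≡term∘suc : ∀ i → - 1ℚ * term′ i ≡ term (suc i)
    -term′≡term∘suc i = solve 2 (λ a b → (:- con 1ℚ) :* (a :* b) := (:- a) :* b) refl
      (negOnePow (toℕ i)) (F′ (lookup (y ∷ ys) i) (removeAt (y ∷ ys) i))

  sum-permutations-suc : ∀ n (G : List ℤ → ℚ) (s : Vec ℤ (suc n)) →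
    sumℚ (map (λ σ → sgn σ * G (act σ s)) (permutations (suc n))) ≡
    altExpand (λ t r → sumℚ (map (λ τ → sgn τ * G (t ∷ act τ r)) (permutations n))) s
  sum-permutations-suc n G s = begin
      sumℚ (map f (permutations (suc n)))
    ≡⟨ cong (sumℚ ∘ map f) (permutations-suc n) ⟩
      sumℚ (map f (concatMap (λ i → map (extend i) (permutations n)) (allFin (suc n))))
    ≡⟨ sumℚ-concatMap f (λ i → map (extend i) (permutations n)) (allFin (suc n)) ⟩
      sumℚ (map (λ i → sumℚ (map f (map (extend i) (permutations n)))) (allFin (suc n)))
    ≡⟨ cong sumℚ (map-cong expand-first (allFin (suc n))) ⟩
      sumℚ (map (λ i → negOnePow (toℕ i) * Q (lookup s i) (removeAt s i)) (allFin (suc n)))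
    ≡⟨ altExpand-lookup Q s ⟨
      altExpand Q s
    ∎
    where
    f : Vec (Fin (suc n)) (suc n) → ℚ
    f σ = sgn σ * G (act σ s)
    Q : ℤ → Vec ℤ n → ℚ
    Q t r = sumℚ (map (λ τ → sgn τ * G (t ∷ act τ r)) (permutations n))
    f∘extend : ∀ i τ → CountsBelow τ →
      f (extend i τ) ≡ negOnePow (toℕ i) * (sgn τ * G (lookup s i ∷ act τ (removeAt s i)))
    f∘extend i τ counts = trans (cong₂ _*_ (sgn-extend i counts) (cong G (act-extend i τ s)))
      (ℚₚ.*-assoc (negOnePow (toℕ i)) (sgn τ) (G (lookup s i ∷ act τ (removeAt s i))))
    expand-first : ∀ i → sumℚ (map f (map (extend i) (permutations n))) ≡ negOnePow (toℕ i) * Q (lookup s i) (removeAt s i)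
    expand-first i = begin
        sumℚ (map f (map (extend i) (permutations n)))
      ≡⟨ cong sumℚ (map-∘ (permutations n)) ⟨
        sumℚ (map (f ∘ extend i) (permutations n))
      ≡⟨ cong sumℚ (map-cong-local (All.map (λ {τ} → f∘extend i τ) (permutations-CountsBelow n))) ⟩
        sumℚ (map (λ τ → negOnePow (toℕ i) * (sgn τ * G (lookup s i ∷ act τ (removeAt s i)))) (permutations n))
      ≡⟨ sumℚ-*ˡ (negOnePow (toℕ i)) _ (permutations n) ⟩
        negOnePow (toℕ i) * Q (lookup s i) (removeAt s i)
      ∎

  H-suc : ∀ K t l → H (suc (suc K)) (t ∷ l) ≡ H (suc K) (t ∷ l) + powNeg K t * H (suc K) l
  H-suc K t l = begin
      sumℚ (map term (upTo (suc K)))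
    ≡⟨ cong (sumℚ ∘ map term) (applyUpTo-∷ʳ (λ m → m) K) ⟨
      sumℚ (map term (upTo K ++ K ∷ []))
    ≡⟨ sumℚ-++ term (upTo K) (K ∷ []) ⟩
      H (suc K) (t ∷ l) + (term K + 0ℚ)
    ≡⟨ cong (H (suc K) (t ∷ l) +_) (ℚₚ.+-identityʳ (term K)) ⟩
      H (suc K) (t ∷ l) + powNeg K t * H (suc K) l
    ∎
    where
    term : ℕ → ℚ
    term m = powNeg m t * H (suc m) l

  altSumWithHead : (n K : ℕ) → ℤ → Vec ℤ n → ℚ
  altSumWithHead n K t r = sumℚ (map (λ τ → sgn τ * H (suc K) (t ∷ act τ r)) (permutations n))

  altSumHead-suc : ∀ n K t r → altSumWithHead n (suc K) t r ≡ altSumWithHead n K t r + powNeg K t * altSum (suc K) n r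
  altSumHead-suc n K t r = begin
      sumℚ (map (λ τ → sgn τ * H (suc (suc K)) (t ∷ act τ r)) (permutations n))
    ≡⟨ cong sumℚ (map-cong (λ τ → trans (cong (sgn τ *_) (H-suc K t (act τ r)))
                                         (distrib (sgn τ) (H (suc K) (t ∷ act τ r)) (powNeg K t) (H (suc K) (act τ r))))
                           (permutations n)) ⟩
      sumℚ (map (λ τ → sgn τ * H (suc K) (t ∷ act τ r) + powNeg K t * (sgn τ * H (suc K) (act τ r))) (permutations n))
    ≡⟨ sumℚ-+ _ _ (permutations n) ⟩
      altSumWithHead n K t r + sumℚ (map (λ τ → powNeg K t * (sgn τ * H (suc K) (act τ r))) (permutations n))
    ≡⟨ cong (altSumWithHead n K t r +_) (sumℚ-*ˡ (powNeg K t) _ (permutations n)) ⟩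
      altSumWithHead n K t r + powNeg K t * altSum (suc K) n r
    ∎
    where
    distrib : ∀ a b c d → a * (b + c * d) ≡ a * b + c * (a * d)
    distrib = solve 4 (λ a b c d → a :* (b :+ c :* d) := a :* b :+ c :* (a :* d)) refl

  altSum≡alternatingSum : ∀ n K s → altSum (suc K) n s ≡ alternatingSum powNeg n K s
  altExpand-altSumHead : ∀ n K s → altExpand (altSumWithHead n K) s ≡ alternatingSum powNeg (suc n) K s

  altSum≡alternatingSum zero    K [] = refl
  altSum≡alternatingSum (suc n) K s  = trans (sum-permutations-suc n (H (suc K)) s) (altExpand-altSumHead n K s)

  altExpand-altSumHead n zero s =
    altExpand-zero (λ t r → sumℚ-zero (λ τ → ℚₚ.*-zeroʳ (sgn τ)) (permutations n)) s
  altExpand-altSumHead n (suc K) s = begin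
      altExpand (altSumWithHead n (suc K)) s
    ≡⟨ altExpand-cong (altSumHead-suc n K) s ⟩
      altExpand (λ t r → altSumWithHead n K t r + powNeg K t * altSum (suc K) n r) s
    ≡⟨ altExpand-+ (altSumWithHead n K) (λ t r → powNeg K t * altSum (suc K) n r) s ⟩
      altExpand (altSumWithHead n K) s + altExpand (λ t r → powNeg K t * altSum (suc K) n r) s
    ≡⟨ cong₂ _+_ (altExpand-altSumHead n K s)
                 (altExpand-cong (λ t r → cong (powNeg K t *_) (altSum≡alternatingSum n K r)) s) ⟩
      alternatingSum powNeg (suc n) (suc K) s
    ∎

-- Binomial coefficients and power sums

module _ where
  open import Data.Nat using (_+_; _*_; _^_; _<_; z≤n; s≤s)
  open import Data.Nat.Properties
    using ( +-comm; +-assoc; +-identityʳ; +-cancelʳ-≡; *-zeroʳ; *-identityˡ; *-identityʳ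
          ; *-distribˡ-+; *-distribʳ-+; ≤-refl; n<1+n; m<n⇒m<1+n)
  open import Data.Nat.Divisibility using (_∣_; divides; ∣m∣n⇒∣m+n)
  open import Data.Nat.Combinatorics using (_C_; nCn≡1; nC1≡n; k>n⇒nCk≡0; nCk+nC[k+1]≡[n+1]C[k+1])
  open import Data.Nat.Solver using (module +-*-Solver)
  open +-*-Solver
  open ≡-Reasoning

  ∑< : ℕ → (ℕ → ℕ) → ℕ
  ∑< zero    f = 0
  ∑< (suc n) f = ∑< n f + f n

  infix 6.5 ∑<
  syntax ∑< n (λ j → e) = ∑[ j < n ] e

  ∑-front : ∀ n (f : ℕ → ℕ) → ∑[ j < suc n ] f j ≡ f 0 + ∑[ j < n ] f (suc j)
  ∑-front zero    f = +-comm 0 (f 0)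
  ∑-front (suc n) f = trans (cong (_+ f (suc n)) (∑-front n f)) (+-assoc (f 0) _ _)

  ∑-cong : ∀ n {f g : ℕ → ℕ} → (∀ j → f j ≡ g j) → ∑[ j < n ] f j ≡ ∑[ j < n ] g j
  ∑-cong zero    f≗g = refl
  ∑-cong (suc n) f≗g = cong₂ _+_ (∑-cong n f≗g) (f≗g n)

  ∑-+ : ∀ n (f g : ℕ → ℕ) → ∑[ j < n ] (f j + g j) ≡ ∑[ j < n ] f j + ∑[ j < n ] g j
  ∑-+ zero    f g = refl
  ∑-+ (suc n) f g = trans (cong (_+ (f n + g n)) (∑-+ n f g))
    (solve 4 (λ a b c d → (a :+ b) :+ (c :+ d) := (a :+ c) :+ (b :+ d)) refl (∑< n f) (∑< n g) (f n) (g n))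

  ∑-*ˡ : ∀ n c (f : ℕ → ℕ) → ∑[ j < n ] (c * f j) ≡ c * (∑[ j < n ] f j)
  ∑-*ˡ zero    c f = sym (*-zeroʳ c)
  ∑-*ˡ (suc n) c f = trans (cong (_+ c * f n) (∑-*ˡ n c f)) (sym (*-distribˡ-+ c (∑< n f) (f n)))

  ∑-comm : ∀ m n (f : ℕ → ℕ → ℕ) → ∑[ i < m ] ∑[ j < n ] f i j ≡ ∑[ j < n ] ∑[ i < m ] f i j
  ∑-comm zero    n f = sym (∑-zero n)
    where
    ∑-zero : ∀ n → ∑[ j < n ] 0 ≡ 0
    ∑-zero zero    = refl
    ∑-zero (suc n) = cong (_+ 0) (∑-zero n)
  ∑-comm (suc m) n f = trans (cong (_+ ∑[ j < n ] f m j) (∑-comm m n f))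
                             (sym (∑-+ n (λ j → ∑[ i < m ] f i j) (f m)))

  ∣-∑ : ∀ {d} n (f : ℕ → ℕ) → (∀ j → j < n → d ∣ f j) → d ∣ ∑[ j < n ] f j
  ∣-∑ zero    f d∣f = divides 0 refl
  ∣-∑ (suc n) f d∣f = ∣m∣n⇒∣m+n (∣-∑ n f (λ j j<n → d∣f j (m<n⇒m<1+n j<n))) (d∣f n ≤-refl)

  binomial : ∀ x n → suc x ^ n ≡ ∑[ j < suc n ] (n C j) * x ^ j
  binomial x zero    = refl
  binomial x (suc n) = begin
      suc x * suc x ^ n
    ≡⟨ cong (suc x *_) (binomial x n) ⟩
      suc x * S
    ≡⟨ solve 2 (λ x S → (con 1 :+ x) :* S := S :+ x :* S) refl x S ⟩
      S + x * S
    ≡⟨ cong (_+ x * S) S≡1+S⁺ ⟩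
      (1 + S⁺) + x * S
    ≡⟨ solve 3 (λ S⁺ x S → (con 1 :+ S⁺) :+ x :* S := con 1 :+ (x :* S :+ S⁺)) refl S⁺ x S ⟩
      1 + (x * S + S⁺)
    ≡⟨ cong (λ z → 1 + (z + S⁺)) x*S ⟨
      1 + (∑[ j < suc n ] (n C j) * x ^ suc j + S⁺)
    ≡⟨ cong (1 +_) (∑-+ (suc n) (λ j → (n C j) * x ^ suc j) (λ j → (n C suc j) * x ^ suc j)) ⟨
      1 + ∑[ j < suc n ] ((n C j) * x ^ suc j + (n C suc j) * x ^ suc j)
    ≡⟨ cong (1 +_) (∑-cong (suc n) (λ j → trans (sym (*-distribʳ-+ (x ^ suc j) (n C j) (n C suc j)))
                                                (cong (_* x ^ suc j) (nCk+nC[k+1]≡[n+1]C[k+1] n j)))) ⟩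
      1 + ∑[ j < suc n ] (suc n C suc j) * x ^ suc j
    ≡⟨ ∑-front (suc n) (λ j → (suc n C j) * x ^ j) ⟨
      ∑[ j < suc (suc n) ] (suc n C j) * x ^ j
    ∎
    where
    S S⁺ : ℕ
    S = ∑[ j < suc n ] (n C j) * x ^ j
    S⁺ = ∑[ j < suc n ] (n C suc j) * x ^ suc j
    x*S : ∑[ j < suc n ] (n C j) * x ^ suc j ≡ x * S
    x*S = trans (∑-cong (suc n) (λ j → solve 3 (λ c x y → c :* (x :* y) := x :* (c :* y)) refl (n C j) x (x ^ j)))
                (∑-*ˡ (suc n) x (λ j → (n C j) * x ^ j))
    S≡1+S⁺ : S ≡ 1 + S⁺
    S≡1+S⁺ = trans (∑-front n (λ j → (n C j) * x ^ j))
      (cong (1 +_) (sym (trans (cong (∑< n (λ j → (n C suc j) * x ^ suc j) +_)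
                                     (cong (_* x ^ suc n) (k>n⇒nCk≡0 (n<1+n n))))
                               (+-identityʳ _))))

  [1+k]*[1+n]C[1+k]≡[1+n]*nCk : ∀ n k → suc k * (suc n C suc k) ≡ suc n * (n C k)
  [1+k]*[1+n]C[1+k]≡[1+n]*nCk zero    zero    = refl
  [1+k]*[1+n]C[1+k]≡[1+n]*nCk zero    (suc k) = begin
    suc (suc k) * (1 C suc (suc k))  ≡⟨ cong (suc (suc k) *_) (k>n⇒nCk≡0 {1} {suc (suc k)} (s≤s (s≤s z≤n))) ⟩
    suc (suc k) * 0                  ≡⟨ *-zeroʳ (suc (suc k)) ⟩
    1 * 0                            ≡⟨ cong (1 *_) (k>n⇒nCk≡0 {0} {suc k} (s≤s z≤n)) ⟨
    1 * (0 C suc k)                  ∎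
  [1+k]*[1+n]C[1+k]≡[1+n]*nCk (suc n) zero    =
    trans (*-identityˡ _) (trans (nC1≡n (suc (suc n))) (sym (*-identityʳ (suc (suc n)))))
  [1+k]*[1+n]C[1+k]≡[1+n]*nCk (suc n) (suc k) = begin
      suc (suc k) * (suc (suc n) C suc (suc k))
    ≡⟨ cong (suc (suc k) *_) (nCk+nC[k+1]≡[n+1]C[k+1] (suc n) (suc k)) ⟨
      suc (suc k) * (suc n C suc k + suc n C suc (suc k))
    ≡⟨ solve 3 (λ k a b → (con 2 :+ k) :* (a :+ b) := ((con 1 :+ k) :* a :+ a) :+ (con 2 :+ k) :* b) refl
         k (suc n C suc k) (suc n C suc (suc k)) ⟩
      (suc k * (suc n C suc k) + suc n C suc k) + suc (suc k) * (suc n C suc (suc k))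
    ≡⟨ cong₂ (λ a b → a + suc n C suc k + b) ([1+k]*[1+n]C[1+k]≡[1+n]*nCk n k) ([1+k]*[1+n]C[1+k]≡[1+n]*nCk n (suc k)) ⟩
      (suc n * (n C k) + suc n C suc k) + suc n * (n C suc k)
    ≡⟨ cong (λ z → suc n * (n C k) + z + suc n * (n C suc k)) (nCk+nC[k+1]≡[n+1]C[k+1] n k) ⟨
      (suc n * (n C k) + (n C k + n C suc k)) + suc n * (n C suc k)
    ≡⟨ solve 3 (λ n a b → (con 1 :+ n) :* a :+ (a :+ b) :+ (con 1 :+ n) :* b := (con 2 :+ n) :* (a :+ b)) refl
         n (n C k) (n C suc k) ⟩
      suc (suc n) * (n C k + n C suc k)
    ≡⟨ cong (suc (suc n) *_) (nCk+nC[k+1]≡[n+1]C[k+1] n k) ⟩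
      suc (suc n) * (suc n C suc k)
    ∎

  [1+n]Cn≡1+n : ∀ n → suc n C n ≡ suc n
  [1+n]Cn≡1+n zero    = refl
  [1+n]Cn≡1+n (suc n) = begin
    suc (suc n) C suc n           ≡⟨ nCk+nC[k+1]≡[n+1]C[k+1] (suc n) n ⟨
    suc n C n + suc n C suc n     ≡⟨ cong₂ _+_ ([1+n]Cn≡1+n n) (nCn≡1 (suc n)) ⟩
    suc n + 1                     ≡⟨ +-comm (suc n) 1 ⟩
    suc (suc n)                   ∎

  ∑-powers-identity : ∀ N e →
    ∑[ j < e ] (suc e C j) * (∑[ m < N ] m ^ j) + suc e * (∑[ m < N ] m ^ e) ≡ N ^ suc e
  ∑-powers-identity N e = +-cancelʳ-≡ (S (suc e)) _ _ (begin
      ∑[ j < e ] (suc e C j) * S j + suc e * S e + S (suc e)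
    ≡⟨ cong₂ (λ a b → ∑[ j < e ] (suc e C j) * S j + a * S e + b)
             (sym ([1+n]Cn≡1+n e)) (sym (trans (cong (_* S (suc e)) (nCn≡1 (suc e))) (*-identityˡ (S (suc e))))) ⟩
      ∑[ j < suc (suc e) ] (suc e C j) * S j
    ≡⟨ ∑-cong (suc (suc e)) (λ j → ∑-*ˡ N (suc e C j) (λ m → m ^ j)) ⟨
      ∑[ j < suc (suc e) ] ∑[ m < N ] (suc e C j) * m ^ j
    ≡⟨ ∑-comm N (suc (suc e)) (λ m j → (suc e C j) * m ^ j) ⟨
      ∑[ m < N ] ∑[ j < suc (suc e) ] (suc e C j) * m ^ j
    ≡⟨ ∑-cong N (λ m → binomial m (suc e)) ⟨
      ∑[ m < N ] suc m ^ suc e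
    ≡⟨ ∑-front N (λ m → m ^ suc e) ⟨
      S (suc e) + N ^ suc e
    ≡⟨ +-comm (S (suc e)) (N ^ suc e) ⟩
      N ^ suc e + S (suc e)
    ∎)
    where
    S : ℕ → ℕ
    S j = ∑[ m < N ] m ^ j

-- Fermat's little theorem and power sums modulo a prime

module _ where
  open import Data.Nat using (_^_)
  import Data.Integer as ℤ
  open import Data.Integer using (+_; 0ℤ; 1ℤ)
  import Data.Integer.Properties as ℤₚ
  open import Data.Integer.Divisibility.Signed using (divides; ∣m∣n⇒∣m+n; ∣n⇒∣m*n) renaming (_∣_ to _∣ᶻ_)
  open import Data.Integer.Solver using (module +-*-Solver)
  open +-*-Solver

  ∣a-1⇒∣aᵏ-1 : ∀ {d} a k → d ∣ᶻ + a ℤ.- 1ℤ → d ∣ᶻ + (a ^ k) ℤ.- 1ℤ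
  ∣a-1⇒∣aᵏ-1 a zero    _     = divides 0ℤ refl
  ∣a-1⇒∣aᵏ-1 {d} a (suc k) d∣a-1 =
    subst (d ∣ᶻ_) eq (∣m∣n⇒∣m+n (∣n⇒∣m*n (+ a) (∣a-1⇒∣aᵏ-1 a k d∣a-1)) d∣a-1)
    where
    eq : + a ℤ.* (+ (a ^ k) ℤ.- 1ℤ) ℤ.+ (+ a ℤ.- 1ℤ) ≡ + (a ^ suc k) ℤ.- 1ℤ
    eq = trans (solve 2 (λ a b → a :* (b :- con 1ℤ) :+ (a :- con 1ℤ) := a :* b :- con 1ℤ) refl (+ a) (+ (a ^ k)))
               (cong (ℤ._- 1ℤ) (sym (ℤₚ.pos-* a (a ^ k))))

module _ {r : ℕ} (prime : Prime (suc (suc r))) where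
  open import Data.Nat using (_+_; _*_; _^_; _<_; s≤s; z≤n)
  open import Data.Nat.Properties using (<-trans; *-identityˡ)
  open import Data.Nat.Divisibility using (_∣_; ∣m+n∣m⇒∣n; m∣m*n; ∣n⇒∣m*n; ∣m⇒∣m*n; >⇒∤)
  open import Data.Nat.Primality using (euclidsLemma)
  open import Data.Nat.Induction using (<-rec)
  open import Data.Nat.Combinatorics using (_C_; nCn≡1)
  import Data.Integer as ℤ
  open import Data.Integer using (+_; 0ℤ; 1ℤ)
  import Data.Integer.Properties as ℤₚ
  open import Data.Integer.Divisibility.Signed using (divides; ∣ᵤ⇒∣; ∣⇒∣ᵤ; ∣m∣n⇒∣m+n) renaming (_∣_ to _∣ᶻ_)
  open import Data.Integer.Solver using (module +-*-Solver)
  open +-*-Solver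
  open import Data.Sum using ([_,_]′)
  open import Relation.Nullary using (¬_; contradiction)
  open ≡-Reasoning

  private
    p : ℕ
    p = suc (suc r)

  ∣*-cancelˡ : ∀ {a b} → ¬ p ∣ a → p ∣ a * b → p ∣ b
  ∣*-cancelˡ {a} {b} p∤a p∣ab =
    [ (λ p∣a → contradiction p∣a p∤a) , (λ p∣b → p∣b) ]′ (euclidsLemma a b prime p∣ab)

  ∣ᶻ*-cancelˡ : ∀ {a b} → ¬ + p ∣ᶻ a → + p ∣ᶻ a ℤ.* b → + p ∣ᶻ b
  ∣ᶻ*-cancelˡ {a} {b} p∤a p∣ab =
    ∣ᵤ⇒∣ (∣*-cancelˡ (p∤a ∘ ∣ᵤ⇒∣) (subst (p ∣_) (ℤₚ.abs-* a b) (∣⇒∣ᵤ p∣ab)))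
    where open import Function using (_∘_)

  p∣pCk : ∀ k → 0 < k → k < p → p ∣ p C k
  p∣pCk (suc j) _ j<p =
    ∣*-cancelˡ (>⇒∤ j<p) (subst (p ∣_) (sym ([1+k]*[1+n]C[1+k]≡[1+n]*nCk (suc r) j)) (m∣m*n (suc r C j)))

  fermat : ∀ x → + p ∣ᶻ + (x ^ p) ℤ.- + x
  fermat zero    = divides 0ℤ refl
  fermat (suc x) = subst (+ p ∣ᶻ_) eq (∣m∣n⇒∣m+n (∣ᵤ⇒∣ {+ p} {+ M} p∣M) (fermat x))
    where
    M : ℕ
    M = ∑[ j < suc r ] (p C suc j) * x ^ suc j
    p∣M : p ∣ M
    p∣M = ∣-∑ (suc r) (λ j → (p C suc j) * x ^ suc j)
                (λ j j<r → ∣m⇒∣m*n (x ^ suc j) (p∣pCk (suc j) (s≤s z≤n) (s≤s j<r)))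
    expand : suc x ^ p ≡ 1 + (M + x ^ p)
    expand = begin
      suc x ^ p                                       ≡⟨ binomial x p ⟩
      ∑[ j < suc p ] (p C j) * x ^ j                  ≡⟨ ∑-front p (λ j → (p C j) * x ^ j) ⟩
      1 + (M + (p C p) * x ^ p)                       ≡⟨ cong (λ c → 1 + (M + c * x ^ p)) (nCn≡1 p) ⟩
      1 + (M + 1 * x ^ p)                             ≡⟨ cong (λ z → 1 + (M + z)) (*-identityˡ (x ^ p)) ⟩
      1 + (M + x ^ p)                                 ∎
    eq : + M ℤ.+ (+ (x ^ p) ℤ.- + x) ≡ + (suc x ^ p) ℤ.- + suc x
    eq = trans (solve 3 (λ m y x → m :+ (y :- x) := (con 1ℤ :+ (m :+ y)) :- (con 1ℤ :+ x)) refl (+ M) (+ (x ^ p)) (+ x))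
               (cong (λ z → + z ℤ.- + suc x) (sym expand))

  fermat-unit : ∀ x → ¬ p ∣ x → + p ∣ᶻ + (x ^ suc r) ℤ.- 1ℤ
  fermat-unit x p∤x = ∣ᶻ*-cancelˡ {+ x} (p∤x ∘ ∣⇒∣ᵤ) (subst (+ p ∣ᶻ_) factor (fermat x))
    where
    open import Function using (_∘_)
    factor : + (x ^ p) ℤ.- + x ≡ + x ℤ.* (+ (x ^ suc r) ℤ.- 1ℤ)
    factor = trans (cong (ℤ._- + x) (ℤₚ.pos-* x (x ^ suc r)))
                   (solve 2 (λ a b → a :* b :- a := a :* (b :- con 1ℤ)) refl (+ x) (+ (x ^ suc r)))

  p∣∑-powers : ∀ e → suc e < p → p ∣ ∑[ m < p ] m ^ e
  p∣∑-powers = <-rec (λ e → suc e < p → p ∣ ∑[ m < p ] m ^ e) step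
    where
    step : ∀ e → (∀ {j} → j < e → suc j < p → p ∣ ∑[ m < p ] m ^ j) → suc e < p → p ∣ ∑[ m < p ] m ^ e
    step e below e<p = ∣*-cancelˡ (>⇒∤ e<p)
      (∣m+n∣m⇒∣n (subst (p ∣_) (sym (∑-powers-identity p e)) (m∣m*n (p ^ e)))
                 (∣-∑ e (λ j → (suc e C j) * (∑[ m < p ] m ^ j))
                      (λ j j<e → ∣n⇒∣m*n (suc e C j) (below j<e (<-trans (s≤s j<e) e<p)))))

-- Residues of p-integral rationals

module _ {p : ℕ} (prime : Prime p) where
  import Data.Nat as ℕ
  open import Data.Nat.Divisibility using (_∣_; ∣1⇒≡1)
  open import Data.Nat.Primality using (euclidsLemma; ¬prime[1])
  import Data.Integer as ℤ
  open import Data.Integer using (+_; 0ℤ; 1ℤ)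
  import Data.Integer.Properties as ℤₚ
  open import Data.Integer.Divisibility.Signed
    using (divides; ∣ᵤ⇒∣; ∣⇒∣ᵤ; ∣m∣n⇒∣m+n; ∣m⇒∣-m; ∣m⇒∣m*n; ∣n⇒∣m*n)
    renaming (_∣_ to _∣ᶻ_)
  open import Data.Integer.Solver using (module +-*-Solver)
  open +-*-Solver
  import Data.Rational as ℚ
  open import Data.Rational using (ℚ; 0ℚ; 1ℚ; toℚᵘ)
  open import Data.Rational.Properties using (toℚᵘ-homo-+; toℚᵘ-homo-*; toℚᵘ-homo‿-; toℚᵘ-fromℚᵘ)
  import Data.Rational.Unnormalised as ℚᵘ
  open import Data.Rational.Unnormalised using (ℚᵘ; mkℚᵘ; *≡*; _≃_)
  import Data.Rational.Unnormalised.Properties as ℚᵘₚ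
  open import Data.Product using (∃; _×_; _,_)
  open import Data.Sum using ([_,_]′)
  open import Relation.Nullary using (¬_; contradiction)
  open import Data.Vec.Relation.Unary.All using (All; _∷_)

  -- q ≡ c (mod p) for a p-integral rational q: q = a/d with p ∤ d and a ≡ c d (mod p). The fraction
  -- is taken in ℚᵘ because sums and products of normalised fractions are not computed componentwise.
  HasResidue : ℚ → ℤ → Set
  HasResidue q c = ∃ λ y → toℚᵘ q ≃ y × ¬ p ∣ ℚᵘ.↧ₙ y × + p ∣ᶻ ℚᵘ.↥ y ℤ.- c ℤ.* ℚᵘ.↧ y

  Integral : ℚ → Set
  Integral q = ∃ (HasResidue q)

  p∤1 : ¬ p ∣ 1
  p∤1 p∣1 = ¬prime[1] (subst Prime (∣1⇒≡1 p∣1) prime)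

  p∤* : ∀ {a b} → ¬ p ∣ a → ¬ p ∣ b → ¬ p ∣ a ℕ.* b
  p∤* {a} {b} p∤a p∤b p∣ab = [ p∤a , p∤b ]′ (euclidsLemma a b prime p∣ab)

  HasResidue-+ : ∀ {q q′ c c′} → HasResidue q c → HasResidue q′ c′ → HasResidue (q ℚ.+ q′) (c ℤ.+ c′)
  HasResidue-+ {q} {q′} {c} {c′} (y@(mkℚᵘ a d) , q≃y , p∤d , a≡cd)
                                 (y′@(mkℚᵘ a′ d′) , q′≃y′ , p∤d′ , a′≡c′d′) =
    y ℚᵘ.+ y′ , ℚᵘₚ.≃-trans (toℚᵘ-homo-+ q q′) (ℚᵘₚ.+-cong q≃y q′≃y′) , p∤* p∤d p∤d′ ,
    subst (+ p ∣ᶻ_)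
      (solve 6 (λ a a′ c c′ D D′ → (a :- c :* D) :* D′ :+ (a′ :- c′ :* D′) :* D
                                 := (a :* D′ :+ a′ :* D) :- (c :+ c′) :* (D :* D′))
         refl a a′ c c′ (+ ℕ.suc d) (+ ℕ.suc d′))
      (∣m∣n⇒∣m+n (∣m⇒∣m*n (+ ℕ.suc d′) a≡cd) (∣m⇒∣m*n (+ ℕ.suc d) a′≡c′d′))

  HasResidue-* : ∀ {q q′ c c′} → HasResidue q c → HasResidue q′ c′ → HasResidue (q ℚ.* q′) (c ℤ.* c′)
  HasResidue-* {q} {q′} {c} {c′} (y@(mkℚᵘ a d) , q≃y , p∤d , a≡cd)
                                 (y′@(mkℚᵘ a′ d′) , q′≃y′ , p∤d′ , a′≡c′d′) =
    y ℚᵘ.* y′ , ℚᵘₚ.≃-trans (toℚᵘ-homo-* q q′) (ℚᵘₚ.*-cong q≃y q′≃y′) , p∤* p∤d p∤d′ ,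
    subst (+ p ∣ᶻ_)
      (solve 6 (λ a a′ c c′ D D′ → (a :- c :* D) :* a′ :+ (c :* D) :* (a′ :- c′ :* D′)
                                 := a :* a′ :- (c :* c′) :* (D :* D′))
         refl a a′ c c′ (+ ℕ.suc d) (+ ℕ.suc d′))
      (∣m∣n⇒∣m+n (∣m⇒∣m*n a′ a≡cd) (∣n⇒∣m*n (c ℤ.* + ℕ.suc d) a′≡c′d′))

  HasResidue-neg : ∀ {q c} → HasResidue q c → HasResidue (ℚ.- q) (ℤ.- c)
  HasResidue-neg {q} {c} (y@(mkℚᵘ a d) , q≃y , p∤d , a≡cd) =
    ℚᵘ.- y , ℚᵘₚ.≃-trans (toℚᵘ-homo‿- q) (ℚᵘₚ.-‿cong q≃y) , p∤d ,
    subst (+ p ∣ᶻ_) (solve 3 (λ a c D → :- (a :- c :* D) := (:- a) :- (:- c) :* D) refl a c (+ ℕ.suc d)) (∣m⇒∣-m a≡cd)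

  HasResidue-shift : ∀ {q c c′} → HasResidue q c → + p ∣ᶻ c ℤ.- c′ → HasResidue q c′
  HasResidue-shift {q} {c} {c′} (y@(mkℚᵘ a d) , q≃y , p∤d , a≡cd) c≡c′ = y , q≃y , p∤d ,
    subst (+ p ∣ᶻ_) (solve 4 (λ a c c′ D → (a :- c :* D) :+ (c :- c′) :* D := a :- c′ :* D) refl a c c′ (+ ℕ.suc d))
      (∣m∣n⇒∣m+n a≡cd (∣m⇒∣m*n (+ ℕ.suc d) c≡c′))

  HasResidue-0 : HasResidue 0ℚ 0ℤ
  HasResidue-0 = mkℚᵘ 0ℤ 0 , ℚᵘₚ.≃-refl , p∤1 , divides 0ℤ refl

  HasResidue-1 : HasResidue 1ℚ 1ℤ
  HasResidue-1 = mkℚᵘ 1ℤ 0 , ℚᵘₚ.≃-refl , p∤1 , divides 0ℤ refl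

  HasResidue-/1 : ∀ i → HasResidue (i ℚ./ 1) i
  HasResidue-/1 i = mkℚᵘ i 0 , toℚᵘ-fromℚᵘ (mkℚᵘ i 0) , p∤1 ,
    subst (+ p ∣ᶻ_) (solve 1 (λ i → con 0ℤ := i :- i :* con 1ℤ) refl i) (divides 0ℤ refl)

  HasResidue-1/ : ∀ d .{{_ : ℕ.NonZero d}} c → + p ∣ᶻ c ℤ.* + d ℤ.- 1ℤ → HasResidue (+ 1 ℚ./ d) c
  HasResidue-1/ (ℕ.suc d) c cd≡1 = mkℚᵘ 1ℤ d , toℚᵘ-fromℚᵘ (mkℚᵘ 1ℤ d) , p∤d ,
    subst (+ p ∣ᶻ_) (solve 2 (λ c D → :- (c :* D :- con 1ℤ) := con 1ℤ :- c :* D) refl c (+ ℕ.suc d)) (∣m⇒∣-m cd≡1)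
    where
    p∤d : ¬ p ∣ ℕ.suc d
    p∤d p∣d = p∤1 (∣⇒∣ᵤ (subst (+ p ∣ᶻ_)
                            (solve 2 (λ c D → c :* D :- (c :* D :- con 1ℤ) := con 1ℤ) refl c (+ ℕ.suc d))
                            (∣m∣n⇒∣m+n (∣n⇒∣m*n c (∣ᵤ⇒∣ p∣d)) (∣m⇒∣-m cd≡1))))

  HasResidue-0⇒∣↥ : ∀ {q} → HasResidue q 0ℤ → p ∣ ℤ.∣ ℚ.↥ q ∣
  HasResidue-0⇒∣↥ {ℚ.mkℚ n d-1 _} (mkℚᵘ a d , *≡* nD≡aD′ , p∤d , a≡0) =
    [ (λ p∣n → p∣n) , (λ p∣d → contradiction p∣d p∤d) ]′ (euclidsLemma ℤ.∣ n ∣ (ℕ.suc d) prime p∣nd)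
    where
    p∣nd : p ∣ ℤ.∣ n ∣ ℕ.* ℕ.suc d
    p∣nd = subst (p ∣_) (ℤₚ.abs-* n (+ ℕ.suc d))
             (∣⇒∣ᵤ (subst (+ p ∣ᶻ_) (sym nD≡aD′)
                     (∣m⇒∣m*n (+ ℕ.suc d-1) (subst (+ p ∣ᶻ_) (ℤₚ.+-identityʳ a) a≡0))))

  Integral-+ : ∀ {q q′} → Integral q → Integral q′ → Integral (q ℚ.+ q′)
  Integral-+ (c , res) (c′ , res′) = c ℤ.+ c′ , HasResidue-+ {c = c} {c′ = c′} res res′

  Integral-* : ∀ {q q′} → Integral q → Integral q′ → Integral (q ℚ.* q′)
  Integral-* (c , res) (c′ , res′) = c ℤ.* c′ , HasResidue-* {c = c} {c′ = c′} res res′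

  Integral-neg : ∀ {q} → Integral q → Integral (ℚ.- q)
  Integral-neg (c , res) = ℤ.- c , HasResidue-neg {c = c} res

  HasResidue-∣⇒0 : ∀ {q} S → HasResidue q (+ S) → p ∣ S → HasResidue q 0ℤ
  HasResidue-∣⇒0 S res p∣S =
    HasResidue-shift {c = + S} {c′ = 0ℤ} res (subst (+ p ∣ᶻ_) (sym (ℤₚ.+-identityʳ (+ S))) (∣ᵤ⇒∣ p∣S))

  HasResidue-0-* : ∀ {q q′} → HasResidue q 0ℤ → Integral q′ → HasResidue (q ℚ.* q′) 0ℤ
  HasResidue-0-* res (c , res′) = HasResidue-shift {c = 0ℤ ℤ.* c} {c′ = 0ℤ} (HasResidue-* {c = 0ℤ} {c′ = c} res res′)
    (subst (+ p ∣ᶻ_) (solve 1 (λ c → con 0ℤ := con 0ℤ :* c :- con 0ℤ) refl c) (divides 0ℤ refl))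

  altExpand-integral : ∀ {A : Set} {n} {F : A → Vec A n → ℚ} → (∀ t r → Integral (F t r)) →
    ∀ w → Integral (altExpand F w)
  altExpand-integral {n = ℕ.zero}  F-int (x ∷ [])  = F-int x []
  altExpand-integral {n = ℕ.suc n} F-int (x ∷ xs) =
    Integral-+ (F-int x xs) (Integral-neg (altExpand-integral (λ y ys → F-int y (x ∷ ys)) xs))

  altExpand-residue-0 : ∀ {A : Set} {n} {F : A → Vec A n → ℚ} (P : A → Set) →
    (∀ t r → P t → HasResidue (F t r) 0ℤ) → ∀ w → All P w → HasResidue (altExpand F w) 0ℤ
  altExpand-residue-0 {n = ℕ.zero}  P F-res (x ∷ [])  (px ∷ _)   = F-res x [] px
  altExpand-residue-0 {n = ℕ.suc n} P F-res (x ∷ xs) (px ∷ pxs) =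
    HasResidue-+ {c = 0ℤ} {c′ = 0ℤ} (F-res x xs px)
      (HasResidue-neg {c = 0ℤ} (altExpand-residue-0 P (λ y ys → F-res y (x ∷ ys)) xs pxs))

-- Vanishing of the alternating sum modulo p

module _ {r : ℕ} (prime : Prime (suc (suc r))) where
  open import Data.Nat as ℕ using (_+_; _*_; _^_; _<_; _≤_; _∸_; s≤s; z≤n; s≤s⁻¹)
  open import Data.Nat.Properties
    using ( ≤-refl; ≤-trans; n≤1+n; +-comm; *-identityʳ; ^-distribˡ-+-*; ^-*-assoc; m^n≢0
          ; m∸n+n≡m; m<m+n; m≤m+n; m≤n+m; ≤-<-trans)
  open import Data.Nat.Divisibility using (_∣_; >⇒∤)
  import Data.Integer as ℤ
  open import Data.Integer using (+_; -[1+_]; 0ℤ; 1ℤ)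
  import Data.Integer.Properties as ℤₚ
  open import Data.Integer.Divisibility.Signed using () renaming (_∣_ to _∣ᶻ_)
  import Data.Rational as ℚ
  import Data.Rational.Properties as ℚₚ
  import Data.Vec as Vec
  open import Data.Vec.Relation.Unary.All using (All; []; _∷_)
  import Data.Fin as Fin
  open import Data.Product using (_×_; _,_)
  open import Relation.Nullary using (contradiction)
  open import Function using (_∘_)
  open ≡-Reasoning

  private
    p : ℕ
    p = suc (suc r)

  powNeg-residue : ∀ m {e k} j → e + k ≡ suc r * j → suc m < p → HasResidue prime (powNeg m (+ k)) (+ (suc m ^ e))
  powNeg-residue m {e} {k} j e+k≡ m<p =
    HasResidue-1/ prime (suc m ^ k) {{m^n≢0 (suc m) k}} (+ (suc m ^ e))
      (subst (λ z → + p ∣ᶻ z ℤ.- 1ℤ) (sym x^e*x^k)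
        (∣a-1⇒∣aᵏ-1 (suc m ^ suc r) j (fermat-unit prime (suc m) (>⇒∤ m<p))))
    where
    x^e*x^k : + (suc m ^ e) ℤ.* + (suc m ^ k) ≡ + ((suc m ^ suc r) ^ j)
    x^e*x^k = begin
      + (suc m ^ e) ℤ.* + (suc m ^ k)   ≡⟨ ℤₚ.pos-* (suc m ^ e) (suc m ^ k) ⟨
      + (suc m ^ e * suc m ^ k)         ≡⟨ cong +_ (^-distribˡ-+-* (suc m) e k) ⟨
      + (suc m ^ (e + k))               ≡⟨ cong (λ z → + (suc m ^ z)) e+k≡ ⟩
      + (suc m ^ (suc r * j))           ≡⟨ cong +_ (^-*-assoc (suc m) (suc r) j) ⟨
      + ((suc m ^ suc r) ^ j)           ∎

  powNeg-integral : ∀ m t → suc m < p → Integral prime (powNeg m t)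
  powNeg-integral m (+ k)    m<p = + (suc m ^ (r * k)) , powNeg-residue m {r * k} {k} k (+-comm (r * k) k) m<p
  powNeg-integral m -[1+ k ] _   = + (suc m ^ suc k) , HasResidue-/1 prime (+ (suc m ^ suc k))

  alternatingSum-integral : ∀ n K w → K ≤ suc r → Integral prime (alternatingSum powNeg n K w)
  alternatingSum-integral zero    K       []  _  = 1ℤ , HasResidue-1 prime
  alternatingSum-integral (suc n) zero    w   _  = 0ℤ , HasResidue-0 prime
  alternatingSum-integral (suc n) (suc K) w   K< =
    Integral-+ prime (alternatingSum-integral (suc n) K w K≤)
      (altExpand-integral prime (λ t rest → Integral-* prime (powNeg-integral K t (s≤s K<))
                                                              (alternatingSum-integral n K rest K≤)) w)
    where
    K≤ : K ≤ suc r
    K≤ = ≤-trans (n≤1+n K) K<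

  powerSum-residue : ∀ (c : ℕ → ℕ) {t} → (∀ m → suc m < p → HasResidue prime (powNeg m t) (+ c m)) →
    ∀ K → K ≤ suc r → HasResidue prime (powerSum powNeg K t) (+ (∑[ m < K ] c m))
  powerSum-residue c res zero    _  = HasResidue-0 prime
  powerSum-residue c res (suc K) K< = HasResidue-+ prime {c = + (∑[ m < K ] c m)} {c′ = + c K}
    (powerSum-residue c res K (≤-trans (n≤1+n K) K<)) (res K (s≤s K<))

  -- By Fermat m^{-t} ≡ m^e with e > 0 and e + |t| = p - 1 (t > 0) or e = |t| (t < 0), and p ∣ Σ_{m<p} m^e.
  powerSum-residue-0 : ∀ t → t ≢ 0ℤ → suc ℤ.∣ t ∣ < p → HasResidue prime (powerSum powNeg (suc r) t) 0ℤ
  powerSum-residue-0 (+ zero)    t≢0 _   = contradiction refl t≢0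
  powerSum-residue-0 (+ suc k)   _   t<p =
    HasResidue-∣⇒0 prime _
      (powerSum-residue (λ m → suc m ^ suc f) (λ m → powNeg-residue m {suc f} {suc k} 1 e+k≡) (suc r) ≤-refl)
      (subst (p ∣_) (∑-front (suc r) (λ m → m ^ suc f)) (p∣∑-powers prime (suc f) (s≤s (s≤s f<r))))
    where
    f : ℕ
    f = r ∸ suc k
    f+k≡r : f + suc k ≡ r
    f+k≡r = m∸n+n≡m (s≤s⁻¹ (s≤s⁻¹ t<p))
    e+k≡ : suc f + suc k ≡ suc r * 1
    e+k≡ = trans (cong suc f+k≡r) (sym (*-identityʳ (suc r)))
    f<r : f < r
    f<r = subst (f <_) f+k≡r (m<m+n f (s≤s z≤n))
  powerSum-residue-0 -[1+ k ]    _   t<p =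
    HasResidue-∣⇒0 prime _
      (powerSum-residue (λ m → suc m ^ suc k) (λ m _ → HasResidue-/1 prime (+ (suc m ^ suc k))) (suc r) ≤-refl)
      (subst (p ∣_) (∑-front (suc r) (λ m → m ^ suc k)) (p∣∑-powers prime (suc k) t<p))

  Admissible : ℤ → Set
  Admissible t = t ≢ 0ℤ × suc ℤ.∣ t ∣ < p

  entries-admissible : ∀ {n} (s : Vec ℤ n) → (∀ i → lookup s i ≢ 0ℤ) →
    suc (Vec.sum (Vec.map ℤ.∣_∣ s)) < p → All Admissible s
  entries-admissible []      _     _   = []
  entries-admissible (x ∷ s) s≢0 Σ<p =
    (s≢0 Fin.zero , ≤-<-trans (s≤s (m≤m+n ℤ.∣ x ∣ _)) Σ<p) ∷
    entries-admissible s (s≢0 ∘ Fin.suc) (≤-<-trans (s≤s (m≤n+m _ ℤ.∣ x ∣)) Σ<p)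

  altSum-residue-0 : ∀ n → n % 2 ≡ 1 → (s : Vec ℤ n) → All Admissible s → HasResidue prime (altSum p n s) 0ℤ
  altSum-residue-0 (suc n) odd s admissible = subst (λ q → HasResidue prime q 0ℤ) (sym newton)
    (altExpand-residue-0 prime Admissible
      (λ t rest (t≢0 , t<p) → HasResidue-0-* prime (powerSum-residue-0 t t≢0 t<p)
                                                (alternatingSum-integral n (suc r) rest ≤-refl))
      s admissible)
    where
    newton : altSum p (suc n) s ≡ altExpand (λ t rest → powerSum powNeg (suc r) t ℚ.* alternatingSum powNeg n (suc r) rest) s
    newton = begin
      altSum p (suc n) s            ≡⟨ altSum≡alternatingSum (suc n) (suc r) s ⟩
      D                             ≡⟨ ℚₚ.*-identityˡ D ⟨
      ℚ.1ℚ ℚ.* D                    ≡⟨ cong (ℚ._* D) (parity-odd (suc n) odd) ⟨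
      parity (suc n) ℚ.* D          ≡⟨ altExpand-powerSum powNeg (suc r) n s ⟨
      altExpand (λ t rest → powerSum powNeg (suc r) t ℚ.* alternatingSum powNeg n (suc r) rest) s ∎
      where
      D : ℚ.ℚ
      D = alternatingSum powNeg (suc n) (suc r) s

corollary4p5 : (n : ℕ) → n % 2 ≡ 1 → (s : Vec ℤ n) →
    (∀ i → lookup s i ≢ 0ℤ) →
    (∀ (i j : Fin n) → lookup s i ≡ lookup s j → i ≡ j) →
    ZeroInA (λ p → altSum p n s)
corollary4p5 n odd s s≢0 _ = suc (Vec.sum (Vec.map ℤ.∣_∣ s)) , p∣altSum
  where
  -- Distinctness of the entries is not needed: with a repeated entry the alternating sum vanishes anyway.
  import Data.Nat as ℕ
  import Data.Integer as ℤ
  import Data.Rational as ℚ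
  import Data.Vec as Vec
  open import Data.Nat.Divisibility using (_∣_)
  open import Data.Product using (_,_)
  p∣altSum : ∀ p → Prime p → suc (Vec.sum (Vec.map ℤ.∣_∣ s)) ℕ.< p → p ∣ ℤ.∣ ℚ.↥ (altSum p n s) ∣
  -- The cases p = 0 and p = 1 are absurd, Prime 0 and Prime 1 being empty.
  p∣altSum (suc (suc r)) isPrime Σ<p =
    HasResidue-0⇒∣↥ isPrime (altSum-residue-0 isPrime n odd s (entries-admissible isPrime s s≢0 Σ<p))
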